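{- A regular $n$-tournament is $(n-1)$-spectrally monomorphic if and only if it is $(n-1)$-skew-spectrally monomorphic.
   Context: An $n$-tournament is a digraph on $n$ vertices in which every pair of distinct vertices is joined by exactly one arc; if the arc goes from $u$ to $v$, $u$ dominates $v$. Its adjacency matrix $A=(a_{ij})$ (w.r.t. an ordering $v_1,\dots,v_n$) has $a_{ij}=1$ if $v_i$ dominates $v_j$ and $0$ otherwise; its skew-adjacency matrix is $S=A-A^{\top}$. A tournament is regular if all vertices dominate the same number of vertices. A square matrix is $k$-spectrally monomorphic if all its $k\times k$ principal submatrices have the same characteristic polynomial $\det(zI-M)$. A tournament is $k$-spectrally monomorphic if its adjacency matrix is $k$-spectrally monomorphic, and $k$-skew-spectrally monomorphic if its skew-adjacency matrix is $k$-spectrally monomorphic. -}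

module Defs where

open import Data.Nat using (ℕ; zero; suc; _∸_)
open import Data.Integer as ℤ using (ℤ; +_; -_)
open import Data.Fin using (Fin; punchIn)
import Data.Fin as F
open import Data.List using (List; []; _∷_)
open import Data.Bool using (Bool; true; false; if_then_else_)
open import Data.Product using (∃)
open import Data.Empty using (⊥)
open import Relation.Nullary using (does; ¬_)
open import Relation.Binary.PropositionalEquality using (_≡_; _≢_)
open import Function using (_⇔_)

-- Univariate polynomials over ℤ, as coefficient lists (lowest degree first)

Poly : Set
Poly = List ℤ

coeff : Poly → ℕ → ℤ
coeff []       _       = + 0
coeff (a ∷ p)  zero    = a
coeff (a ∷ p)  (suc i) = coeff p i

_≈ₚ_ : Poly → Poly → Set
p ≈ₚ q = ∀ i → coeff p i ≡ coeff q i

_+ₚ_ : Poly → Poly → Poly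
[]      +ₚ q       = q
p       +ₚ []      = p
(a ∷ p) +ₚ (b ∷ q) = (a ℤ.+ b) ∷ (p +ₚ q)

scaleₚ : ℤ → Poly → Poly
scaleₚ c []      = []
scaleₚ c (a ∷ p) = (c ℤ.* a) ∷ scaleₚ c p

_*ₚ_ : Poly → Poly → Poly
[]      *ₚ q = []
(a ∷ p) *ₚ q = scaleₚ a q +ₚ (+ 0 ∷ (p *ₚ q))

negₚ : Poly → Poly
negₚ = scaleₚ (- (+ 1))

constₚ : ℤ → Poly
constₚ a = a ∷ []

Xₚ : Poly
Xₚ = + 0 ∷ + 1 ∷ []

sumFin : ∀ {n} → (Fin n → Poly) → Poly
sumFin {zero}  f = []
sumFin {suc n} f = f F.zero +ₚ sumFin (λ i → f (F.suc i))

sgn : ℕ → ℤ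
sgn zero    = + 1
sgn (suc n) = - sgn n

det : ∀ k → (Fin k → Fin k → Poly) → Poly
det zero    M = constₚ (+ 1)
det (suc k) M =
  sumFin (λ j → scaleₚ (sgn (F.toℕ j))
                  (M F.zero j *ₚ det k (λ r c → M (F.suc r) (punchIn j c))))

charPoly : ∀ k → (Fin k → Fin k → ℤ) → Poly
charPoly k M = det k (λ i j →
  (if does (i F.≟ j) then Xₚ else []) +ₚ negₚ (constₚ (M i j)))

StrictlyIncreasing : ∀ {k n} → (Fin k → Fin n) → Set
StrictlyIncreasing f = ∀ i j → i F.< j → f i F.< f j

principalSub : ∀ {k n} → (Fin k → Fin n) → (Fin n → Fin n → ℤ) → Fin k → Fin k → ℤ
principalSub f M i j = M (f i) (f j)

SpectrallyMonomorphic : ∀ {n} → ℕ → (Fin n → Fin n → ℤ) → Set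
SpectrallyMonomorphic {n} k M =
  ∀ (f g : Fin k → Fin n) → StrictlyIncreasing f → StrictlyIncreasing g →
  charPoly k (principalSub f M) ≈ₚ charPoly k (principalSub g M)

record Tournament (n : ℕ) : Set where
  field
    dom     : Fin n → Fin n → Bool      -- dom i j ≡ true : v_i dominates v_j
    irrefl  : ∀ i → dom i i ≡ false
    total   : ∀ i j → i ≢ j → dom i j ≡ true → dom j i ≡ false
    connex  : ∀ i j → i ≢ j → dom i j ≡ false → dom j i ≡ true
open Tournament public

b2z : Bool → ℤ
b2z true  = + 1
b2z false = + 0

adj : ∀ {n} → Tournament n → Fin n → Fin n → ℤ
adj T i j = b2z (dom T i j)

skewAdj : ∀ {n} → Tournament n → Fin n → Fin n → ℤ
skewAdj T i j = adj T i j ℤ.- adj T j i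

countFin : ∀ {n} → (Fin n → Bool) → ℕ
countFin {zero}  p = 0
countFin {suc n} p = (if p F.zero then 1 else 0) Data.Nat.+ countFin (λ i → p (F.suc i))

outdeg : ∀ {n} → Tournament n → Fin n → ℕ
outdeg T i = countFin (dom T i)

Regular : ∀ {n} → Tournament n → Set
Regular {n} T = ∃ λ d → ∀ i → outdeg T i ≡ d

kSpecMono : ∀ {n} → ℕ → Tournament n → Set
kSpecMono k T = SpectrallyMonomorphic k (adj T)

kSkewSpecMono : ∀ {n} → ℕ → Tournament n → Set
kSkewSpecMono k T = SpectrallyMonomorphic k (skewAdj T)

{-# OPTIONS --safe #-}
-- Let A be the adjacency matrix of a regular tournament on n = m + 1 vertices with out-degree d.
-- Then A + Aᵀ = J − I, so every column sum of A is d as well, and S = A − Aᵀ = 2A − J + I.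
-- Put Y(z) = (z − 1)I − 2A, all of whose row and column sums equal s(z) = z − 1 − 2d.  Deleting a
-- vertex v gives det(zI − S_v) = det(Y(z)_v + J) and 2^m det(xI − A_v) = det(Y(2x + 1)_v).
-- For any P with all line sums s, deleting its first row and column leaves M with
-- s² det(M + J) = s(s + n) det M − det P.  Moving v to the front of Y(z), rows and columns alike,
-- does not change det Y(z), so s² det(Y(z)_v + J) = s(s + n) det(Y(z)_v) − det Y(z) with
-- coefficients independent of v.  For the infinitely many z with s(z)(s(z) + n) ≠ 0, one side is
-- independent of v iff the other is, and integer polynomials agreeing at infinitely many points are
-- equal.  Finally, the principal submatrices of order n − 1 are exactly those obtained by deleting
-- one vertex.
module Submission where

open import Defs
open import Data.Nat as ℕ using (ℕ; zero; suc; _∸_; _≤_; _<_; _⊔_)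
import Data.Nat.Properties as ℕP
open import Data.Integer as ℤ using (ℤ; +_; -_; _+_; _*_; _-_; ∣_∣)
import Data.Integer.Properties as ℤP
open import Data.Integer.Tactic.RingSolver using (solve-∀)
open import Data.Fin as F using (Fin; punchIn; punchOut; toℕ)
open import Data.Fin.Induction using (<-weakInduction)
open import Data.Vec.Functional using (updateAt)
open import Data.Vec.Functional.Properties using (updateAt-updates; updateAt-minimal)
import Data.Fin.Properties as FP
open import Data.List using ([]; _∷_)
open import Data.Bool using (Bool; true; false; if_then_else_)
open import Data.Product using (∃-syntax; _×_; _,_; proj₁; proj₂)
open import Data.Sum using (_⊎_; inj₁; inj₂)
open import Function using (_⇔_; mk⇔; _∘_; Equivalence)
open import Relation.Nullary using (¬_; Dec; yes; no; does; contradiction)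
open import Relation.Nullary.Decidable using (dec-true; dec-false)
open import Relation.Binary.PropositionalEquality
open import Algebra.Properties.Semiring.Sum ℤP.+-*-semiring
  using (sum; sum-cong-≗; ∑-distrib-+; ∑-comm; sum-remove; *-distribˡ-sum; *-distribʳ-sum)
open import Algebra.Properties.AbelianGroup ℤP.+-0-abelianGroup using (inverseˡ-unique)

sum-zero : ∀ {n} {f : Fin n → ℤ} → (∀ i → f i ≡ + 0) → sum f ≡ + 0
sum-zero {zero}  f≡0 = refl
sum-zero {suc n} f≡0 = cong₂ _+_ (f≡0 F.zero) (sum-zero (f≡0 ∘ F.suc))

sum-const : ∀ n (c : ℤ) → sum {n} (λ _ → c) ≡ + n * c
sum-const zero    c = refl
sum-const (suc n) c = trans (cong (λ e → c + e) (sum-const n c)) (lemma c (+ n))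
  where lemma : ∀ c n → c + n * c ≡ (+ 1 + n) * c
        lemma = solve-∀

sum-neg : ∀ {n} (f : Fin n → ℤ) → sum (λ i → - f i) ≡ - sum f
sum-neg {zero}  f = refl
sum-neg {suc n} f = trans (cong (λ e → - f F.zero + e) (sum-neg (f ∘ F.suc)))
                          (sym (ℤP.neg-distrib-+ (f F.zero) _))

sum-sub : ∀ {n} (f g : Fin n → ℤ) → sum (λ i → f i - g i) ≡ sum f - sum g
sum-sub f g = trans (∑-distrib-+ f (λ i → - g i)) (cong (λ e → sum f + e) (sum-neg g))

sum-linear : ∀ {n} (α β : ℤ) {f g h : Fin n → ℤ} → (∀ i → f i ≡ α * g i + β * h i) →
             sum f ≡ α * sum g + β * sum h
sum-linear α β {f} {g} {h} f≡ = begin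
  sum f                                   ≡⟨ sum-cong-≗ f≡ ⟩
  sum (λ i → α * g i + β * h i)           ≡⟨ ∑-distrib-+ (λ i → α * g i) (λ i → β * h i) ⟩
  sum (λ i → α * g i) + sum (λ i → β * h i)
    ≡⟨ sym (cong₂ _+_ (*-distribˡ-sum α g) (*-distribˡ-sum β h)) ⟩
  α * sum g + β * sum h                   ∎
  where open ≡-Reasoning

-- Polynomials

eval : Poly → ℤ → ℤ
eval []      x = + 0
eval (a ∷ p) x = a + x * eval p x

eval-+ₚ : ∀ p q x → eval (p +ₚ q) x ≡ eval p x + eval q x
eval-+ₚ []      q       x = sym (ℤP.+-identityˡ _)
eval-+ₚ (a ∷ p) []      x = sym (ℤP.+-identityʳ _)
eval-+ₚ (a ∷ p) (b ∷ q) x =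
  trans (cong (λ e → a + b + x * e) (eval-+ₚ p q x)) (lemma a b x _ _)
  where lemma : ∀ a b x e f → a + b + x * (e + f) ≡ a + x * e + (b + x * f)
        lemma = solve-∀

eval-scaleₚ : ∀ c p x → eval (scaleₚ c p) x ≡ c * eval p x
eval-scaleₚ c []      x = sym (ℤP.*-zeroʳ c)
eval-scaleₚ c (a ∷ p) x =
  trans (cong (λ e → c * a + x * e) (eval-scaleₚ c p x)) (lemma c a x _)
  where lemma : ∀ c a x e → c * a + x * (c * e) ≡ c * (a + x * e)
        lemma = solve-∀

eval-*ₚ : ∀ p q x → eval (p *ₚ q) x ≡ eval p x * eval q x
eval-*ₚ []      q x = refl
eval-*ₚ (a ∷ p) q x = begin
  eval (scaleₚ a q +ₚ (+ 0 ∷ (p *ₚ q))) x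
    ≡⟨ eval-+ₚ (scaleₚ a q) _ x ⟩
  eval (scaleₚ a q) x + (+ 0 + x * eval (p *ₚ q) x)
    ≡⟨ cong₂ (λ u v → u + (+ 0 + x * v)) (eval-scaleₚ a q x) (eval-*ₚ p q x) ⟩
  a * eval q x + (+ 0 + x * (eval p x * eval q x))
    ≡⟨ lemma a x (eval p x) (eval q x) ⟩
  (a + x * eval p x) * eval q x ∎
  where open ≡-Reasoning
        lemma : ∀ a x p q → a * q + (+ 0 + x * (p * q)) ≡ (a + x * p) * q
        lemma = solve-∀

eval-sumFin : ∀ {n} (f : Fin n → Poly) x → eval (sumFin f) x ≡ sum (λ i → eval (f i) x)
eval-sumFin {zero}  f x = refl
eval-sumFin {suc n} f x =
  trans (eval-+ₚ (f F.zero) _ x) (cong (λ e → eval (f F.zero) x + e) (eval-sumFin (f ∘ F.suc) x))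

eval-coeff≡0 : ∀ p → (∀ i → coeff p i ≡ + 0) → ∀ x → eval p x ≡ + 0
eval-coeff≡0 []      p≡0 x = refl
eval-coeff≡0 (a ∷ p) p≡0 x =
  trans (cong₂ (λ u v → u + x * v) (p≡0 0) (eval-coeff≡0 p (p≡0 ∘ suc) x)) (lemma x)
  where lemma : ∀ x → + 0 + x * + 0 ≡ + 0
        lemma = solve-∀

eval-cong : ∀ p q → p ≈ₚ q → ∀ x → eval p x ≡ eval q x
eval-cong []      q       p≈q x = sym (eval-coeff≡0 q (sym ∘ p≈q) x)
eval-cong (a ∷ p) []      p≈q x = eval-coeff≡0 (a ∷ p) p≈q x
eval-cong (a ∷ p) (b ∷ q) p≈q x =
  cong₂ (λ u v → u + x * v) (p≈q 0) (eval-cong p q (p≈q ∘ suc) x)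

coeff-+ₚ : ∀ p q i → coeff (p +ₚ q) i ≡ coeff p i + coeff q i
coeff-+ₚ []      q       i       = sym (ℤP.+-identityˡ _)
coeff-+ₚ (a ∷ p) []      i       = sym (ℤP.+-identityʳ _)
coeff-+ₚ (a ∷ p) (b ∷ q) zero    = refl
coeff-+ₚ (a ∷ p) (b ∷ q) (suc i) = coeff-+ₚ p q i

coeff-scaleₚ : ∀ c p i → coeff (scaleₚ c p) i ≡ c * coeff p i
coeff-scaleₚ c []      i       = sym (ℤP.*-zeroʳ c)
coeff-scaleₚ c (a ∷ p) zero    = refl
coeff-scaleₚ c (a ∷ p) (suc i) = coeff-scaleₚ c p i

InfinitelyMany : (ℕ → Set) → Set
InfinitelyMany P = ∀ N → ∃[ t ] N ≤ t × P t

a+t*e≡0⇒e≡0 : ∀ a e t → ∣ a ∣ < t → a + + t * e ≡ + 0 → e ≡ + 0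
a+t*e≡0⇒e≡0 a e t ∣a∣<t root with e ℤP.≟ + 0
... | yes e≡0 = e≡0
... | no  e≢0 = contradiction ∣a∣<t (ℕP.≤⇒≯ t≤∣a∣)
  where
  instance _ = ℕ.≢-nonZero (e≢0 ∘ ℤP.∣i∣≡0⇒i≡0)
  ∣a∣≡t*∣e∣ : ∣ a ∣ ≡ t ℕ.* ∣ e ∣
  ∣a∣≡t*∣e∣ = begin
    ∣ a ∣              ≡⟨ cong ∣_∣ (inverseˡ-unique a (+ t * e) root) ⟩
    ∣ - (+ t * e) ∣    ≡⟨ ℤP.∣-i∣≡∣i∣ (+ t * e) ⟩
    ∣ + t * e ∣        ≡⟨ ℤP.abs-* (+ t) e ⟩
    t ℕ.* ∣ e ∣        ∎
    where open ≡-Reasoning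
  t≤∣a∣ : t ≤ ∣ a ∣
  t≤∣a∣ = subst (t ≤_) (sym ∣a∣≡t*∣e∣) (ℕP.m≤m*n t ∣ e ∣)

zeros⇒coeff≡0 : ∀ p → InfinitelyMany (λ t → eval p (+ t) ≡ + 0) → ∀ i → coeff p i ≡ + 0
zeros⇒coeff≡0 []      zeros i       = refl
zeros⇒coeff≡0 (a ∷ p) zeros zero    with zeros (suc ∣ a ∣)
... | t , ∣a∣<t , root = begin
  a                   ≡⟨ sym (ℤP.+-identityʳ a) ⟩
  a + + 0             ≡⟨ cong (λ e → a + e) (sym (ℤP.*-zeroʳ (+ t))) ⟩
  a + + t * + 0       ≡⟨ cong (λ e → a + + t * e) (sym (a+t*e≡0⇒e≡0 a _ t ∣a∣<t root)) ⟩
  eval (a ∷ p) (+ t)  ≡⟨ root ⟩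
  + 0                 ∎
  where open ≡-Reasoning
zeros⇒coeff≡0 (a ∷ p) zeros (suc i) = zeros⇒coeff≡0 p tailZeros i
  where
  tailZeros : InfinitelyMany (λ t → eval p (+ t) ≡ + 0)
  tailZeros N with zeros (N ⊔ suc ∣ a ∣)
  ... | t , N⊔∣a∣<t , root =
    t , ℕP.≤-trans (ℕP.m≤m⊔n N _) N⊔∣a∣<t ,
    a+t*e≡0⇒e≡0 a _ t (ℕP.≤-trans (ℕP.m≤n⊔m N _) N⊔∣a∣<t) root

agreeInfinitelyOften⇒≈ₚ : ∀ p q → InfinitelyMany (λ t → eval p (+ t) ≡ eval q (+ t)) → p ≈ₚ q
agreeInfinitelyOften⇒≈ₚ p q agree i = ℤP.i-j≡0⇒i≡j _ _ (begin
  coeff p i - coeff q i                 ≡⟨ cong (λ e → coeff p i + e) (lemma (coeff q i)) ⟩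
  coeff p i + - (+ 1) * coeff q i
    ≡⟨ sym (trans (coeff-+ₚ p (negₚ q) i) (cong (λ e → coeff p i + e) (coeff-scaleₚ _ q i))) ⟩
  coeff (p +ₚ negₚ q) i                 ≡⟨ zeros⇒coeff≡0 (p +ₚ negₚ q) zeros i ⟩
  + 0                                   ∎)
  where
  open ≡-Reasoning
  lemma : ∀ x → - x ≡ - (+ 1) * x
  lemma = solve-∀
  zeros : InfinitelyMany (λ t → eval (p +ₚ negₚ q) (+ t) ≡ + 0)
  zeros N with agree N
  ... | t , N≤t , p≡q = t , N≤t , (begin
    eval (p +ₚ negₚ q) (+ t)                 ≡⟨ eval-+ₚ p (negₚ q) (+ t) ⟩
    eval p (+ t) + eval (negₚ q) (+ t)       ≡⟨ cong (λ e → eval p (+ t) + e) (eval-scaleₚ _ q (+ t)) ⟩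
    eval p (+ t) + - (+ 1) * eval q (+ t)    ≡⟨ cong₂ _+_ p≡q (sym (lemma (eval q (+ t)))) ⟩
    eval q (+ t) - eval q (+ t)              ≡⟨ ℤP.+-inverseʳ (eval q (+ t)) ⟩
    + 0                                      ∎)

-- Integer determinants

Mat : ℕ → Set
Mat k = Fin k → Fin k → ℤ

sg : ∀ {n} → Fin n → ℤ
sg j = sgn (toℕ j)

minor : ∀ {k} → Fin (suc k) → Mat (suc k) → Mat k
minor j M r c = M (F.suc r) (punchIn j c)

detℤ : ∀ k → Mat k → ℤ
detℤ zero    M = + 1
detℤ (suc k) M = sum λ j → sg j * (M F.zero j * detℤ k (minor j M))

detℤ-cong : ∀ k {M N : Mat k} → (∀ i j → M i j ≡ N i j) → detℤ k M ≡ detℤ k N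
detℤ-cong zero    M≡N = refl
detℤ-cong (suc k) M≡N = sum-cong-≗ λ j →
  cong₂ (λ a d → sg j * (a * d)) (M≡N F.zero j) (detℤ-cong k λ r c → M≡N (F.suc r) (punchIn j c))

scalarMat : ∀ {k} → ℤ → Mat k
scalarMat x i j = if does (i F.≟ j) then x else + 0

eval-det : ∀ k (M : Fin k → Fin k → Poly) x → eval (det k M) x ≡ detℤ k (λ i j → eval (M i j) x)
eval-det zero    M x = trans (cong (λ e → + 1 + e) (ℤP.*-zeroʳ x)) (ℤP.+-identityʳ (+ 1))
eval-det (suc k) M x = trans (eval-sumFin (λ j → scaleₚ (sg j) (M F.zero j *ₚ det k (minorP j))) x) (sum-cong-≗ λ j → begin
  eval (scaleₚ (sg j) (M F.zero j *ₚ det k (minorP j))) x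
    ≡⟨ eval-scaleₚ (sg j) (M F.zero j *ₚ det k (minorP j)) x ⟩
  sg j * eval (M F.zero j *ₚ det k (minorP j)) x
    ≡⟨ cong (sg j *_) (eval-*ₚ (M F.zero j) (det k (minorP j)) x) ⟩
  sg j * (eval (M F.zero j) x * eval (det k (minorP j)) x)
    ≡⟨ cong (λ d → sg j * (eval (M F.zero j) x * d)) (eval-det k (minorP j) x) ⟩
  sg j * (eval (M F.zero j) x * detℤ k (minor j (λ r c → eval (M r c) x))) ∎)
  where
  open ≡-Reasoning
  minorP : Fin (suc k) → Fin k → Fin k → Poly
  minorP j r c = M (F.suc r) (punchIn j c)

eval-charPoly : ∀ k M x → eval (charPoly k M) x ≡ detℤ k (λ i j → scalarMat x i j - M i j)
eval-charPoly k M x = trans (eval-det k _ x) (detℤ-cong k λ i j → entry (does (i F.≟ j)) (M i j))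
  where
  entry : ∀ b a → eval ((if b then Xₚ else []) +ₚ negₚ (constₚ a)) x ≡ (if b then x else + 0) - a
  entry true  a = trans (eval-+ₚ Xₚ (negₚ (constₚ a)) x) (lemma a x)
    where lemma : ∀ a x → + 0 + x * (+ 1 + x * + 0) + (- (+ 1) * a + x * + 0) ≡ x - a
          lemma = solve-∀
  entry false a = lemma a x
    where lemma : ∀ a x → - (+ 1) * a + x * + 0 ≡ + 0 - a
          lemma = solve-∀

detℤ-linearInCol : ∀ k (c : Fin k) (α β : ℤ) (A B C : Mat k) →
  (∀ i → A i c ≡ α * B i c + β * C i c) →
  (∀ i j → j ≢ c → A i j ≡ B i j) → (∀ i j → j ≢ c → A i j ≡ C i j) →
  detℤ k A ≡ α * detℤ k B + β * detℤ k C
detℤ-linearInCol (suc k) c α β A B C atc A≡B A≡C = sum-linear α β term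
  where
  minor≡ : ∀ {X Y : Mat (suc k)} → (∀ i j → j ≢ c → X i j ≡ Y i j) →
           detℤ k (minor c X) ≡ detℤ k (minor c Y)
  minor≡ X≡Y = detℤ-cong k λ r x → X≡Y (F.suc r) _ (FP.punchInᵢ≢i c x)
  term : ∀ j → sg j * (A F.zero j * detℤ k (minor j A)) ≡
               α * (sg j * (B F.zero j * detℤ k (minor j B))) + β * (sg j * (C F.zero j * detℤ k (minor j C)))
  term j with j F.≟ c
  ... | yes refl = begin
    sg j * (A F.zero j * detℤ k (minor j A))
      ≡⟨ cong (λ a → sg j * (a * detℤ k (minor j A))) (atc F.zero) ⟩
    sg j * ((α * B F.zero j + β * C F.zero j) * detℤ k (minor j A))
      ≡⟨ lemma (sg j) α β (B F.zero j) (C F.zero j) _ ⟩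
    α * (sg j * (B F.zero j * detℤ k (minor j A))) + β * (sg j * (C F.zero j * detℤ k (minor j A)))
      ≡⟨ cong₂ (λ u v → α * (sg j * (B F.zero j * u)) + β * (sg j * (C F.zero j * v)))
               (minor≡ A≡B) (minor≡ A≡C) ⟩
    α * (sg j * (B F.zero j * detℤ k (minor j B))) + β * (sg j * (C F.zero j * detℤ k (minor j C))) ∎
    where
    open ≡-Reasoning
    lemma : ∀ s α β b c d → s * ((α * b + β * c) * d) ≡ α * (s * (b * d)) + β * (s * (c * d))
    lemma = solve-∀
  ... | no j≢c = begin
    sg j * (A F.zero j * detℤ k (minor j A))
      ≡⟨ cong₂ (λ a d → sg j * (a * d)) (A≡B F.zero j j≢c)
               (detℤ-linearInCol k c′ α β (minor j A) (minor j B) (minor j C) atc′ (off A≡B) (off A≡C)) ⟩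
    sg j * (B F.zero j * (α * detℤ k (minor j B) + β * detℤ k (minor j C)))
      ≡⟨ lemma (sg j) (B F.zero j) α β _ _ ⟩
    α * (sg j * (B F.zero j * detℤ k (minor j B))) + β * (sg j * (B F.zero j * detℤ k (minor j C)))
      ≡⟨ cong (λ a → α * (sg j * (B F.zero j * detℤ k (minor j B))) + β * (sg j * (a * detℤ k (minor j C))))
              (trans (sym (A≡B F.zero j j≢c)) (A≡C F.zero j j≢c)) ⟩
    α * (sg j * (B F.zero j * detℤ k (minor j B))) + β * (sg j * (C F.zero j * detℤ k (minor j C))) ∎
    where
    open ≡-Reasoning
    lemma : ∀ s a α β x y → s * (a * (α * x + β * y)) ≡ α * (s * (a * x)) + β * (s * (a * y))
    lemma = solve-∀
    c′ = punchOut j≢c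
    punchIn-c′ : punchIn j c′ ≡ c
    punchIn-c′ = FP.punchIn-punchOut j≢c
    atc′ : ∀ r → minor j A r c′ ≡ α * minor j B r c′ + β * minor j C r c′
    atc′ r = subst (λ x → A (F.suc r) x ≡ α * B (F.suc r) x + β * C (F.suc r) x) (sym punchIn-c′) (atc (F.suc r))
    off : ∀ {X} → (∀ i j → j ≢ c → A i j ≡ X i j) → ∀ r x → x ≢ c′ → minor j A r x ≡ minor j X r x
    off A≡X r x x≢c′ = A≡X (F.suc r) _ (λ e → x≢c′ (FP.punchIn-injective j x c′ (trans e (sym punchIn-c′))))

-- Interchanging two adjacent rows or columns

record Transposed {n} (a b : Fin n) (u v : Fin n → ℤ) : Set where
  field
    at₁       : u a ≡ v b
    at₂       : u b ≡ v a
    elsewhere : ∀ {j} → j ≢ a → j ≢ b → u j ≡ v j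
open Transposed

data Adjacent : ∀ {n} → Fin n → Fin n → Set where
  adjacent₀ : ∀ {n} → Adjacent {suc (suc n)} F.zero (F.suc F.zero)
  adjacentₛ : ∀ {n} {a b : Fin n} → Adjacent a b → Adjacent (F.suc a) (F.suc b)

Adjacent⇒≢ : ∀ {n} {a b : Fin n} → Adjacent a b → a ≢ b
Adjacent⇒≢ adjacent₀        ()
Adjacent⇒≢ (adjacentₛ adj) a≡b = Adjacent⇒≢ adj (FP.suc-injective a≡b)

Adjacent-sg : ∀ {n} {a b : Fin n} → Adjacent a b → sg b ≡ - sg a
Adjacent-sg adjacent₀       = refl
Adjacent-sg (adjacentₛ adj) = cong -_ (Adjacent-sg adj)

Adjacent-inject₁ : ∀ {n} (w : Fin n) → Adjacent (F.inject₁ w) (F.suc w)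
Adjacent-inject₁ F.zero    = adjacent₀
Adjacent-inject₁ (F.suc w) = adjacentₛ (Adjacent-inject₁ w)

Adjacent-punchOut : ∀ {n} {a b : Fin (suc n)} → Adjacent a b → ∀ {j} (j≢a : j ≢ a) (j≢b : j ≢ b) →
                    Adjacent (punchOut j≢a) (punchOut j≢b)
Adjacent-punchOut adjacent₀                  {F.zero}               j≢a j≢b = contradiction refl j≢a
Adjacent-punchOut adjacent₀                  {F.suc F.zero}         j≢a j≢b = contradiction refl j≢b
Adjacent-punchOut {suc (suc n)} adjacent₀    {F.suc (F.suc j)}      j≢a j≢b = adjacent₀
Adjacent-punchOut (adjacentₛ adj)            {F.zero}               j≢a j≢b = adj
Adjacent-punchOut {suc n} (adjacentₛ adj)    {F.suc j}              j≢a j≢b =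
  adjacentₛ (Adjacent-punchOut adj (j≢a ∘ cong F.suc) (j≢b ∘ cong F.suc))

Adjacent-punchIn : ∀ {n} {a b : Fin (suc n)} → Adjacent a b → ∀ x →
                   punchIn a x ≡ punchIn b x ⊎ (punchIn a x ≡ b × punchIn b x ≡ a)
Adjacent-punchIn adjacent₀       F.zero    = inj₂ (refl , refl)
Adjacent-punchIn adjacent₀       (F.suc x) = inj₁ refl
Adjacent-punchIn (adjacentₛ adj) F.zero    = inj₁ refl
Adjacent-punchIn (adjacentₛ adj) (F.suc x) with Adjacent-punchIn adj x
... | inj₁ e          = inj₁ (cong F.suc e)
... | inj₂ (e₁ , e₂) = inj₂ (cong F.suc e₁ , cong F.suc e₂)

Transposed-sym : ∀ {n} {a b : Fin n} {u v} → Transposed a b u v → Transposed a b v u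
Transposed-sym u⇄v = record
  { at₁ = sym (at₂ u⇄v) ; at₂ = sym (at₁ u⇄v) ; elsewhere = λ j≢a j≢b → sym (elsewhere u⇄v j≢a j≢b) }

Transposed-punchIn : ∀ {n} {a b : Fin (suc n)} {u v} → Adjacent a b → Transposed a b u v →
                     ∀ x → u (punchIn a x) ≡ v (punchIn b x)
Transposed-punchIn {a = a} {b} {u} {v} adj u⇄v x with Adjacent-punchIn adj x
... | inj₁ e = trans (elsewhere u⇄v (FP.punchInᵢ≢i a x) (λ e′ → FP.punchInᵢ≢i b x (trans (sym e) e′)))
                     (cong v e)
... | inj₂ (e₁ , e₂) = trans (cong u e₁) (trans (at₂ u⇄v) (cong v (sym e₂)))

Transposed-punchOut : ∀ {n} {a b j : Fin (suc n)} {u v} (j≢a : j ≢ a) (j≢b : j ≢ b) →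
                      Transposed a b u v → Transposed (punchOut j≢a) (punchOut j≢b) (u ∘ punchIn j) (v ∘ punchIn j)
Transposed-punchOut {j = j} {u} {v} j≢a j≢b u⇄v = record
  { at₁       = trans (cong u (FP.punchIn-punchOut j≢a)) (trans (at₁ u⇄v) (cong v (sym (FP.punchIn-punchOut j≢b))))
  ; at₂       = trans (cong u (FP.punchIn-punchOut j≢b)) (trans (at₂ u⇄v) (cong v (sym (FP.punchIn-punchOut j≢a))))
  ; elsewhere = λ {x} x≢a′ x≢b′ → elsewhere u⇄v (avoid j≢a x≢a′) (avoid j≢b x≢b′)
  }
  where
  avoid : ∀ {c x} (j≢c : j ≢ c) → x ≢ punchOut j≢c → punchIn j x ≢ c
  avoid {x = x} j≢c x≢c′ e = x≢c′ (FP.punchIn-injective j x _ (trans e (sym (FP.punchIn-punchOut j≢c))))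

sum-supportedOnPair : ∀ {n} {a b : Fin n} → a ≢ b → (f : Fin n → ℤ) →
                      (∀ j → j ≢ a → j ≢ b → f j ≡ + 0) → sum f ≡ f a + f b
sum-supportedOnPair {suc zero}    {F.zero} {F.zero} a≢b f off = contradiction refl a≢b
sum-supportedOnPair {suc (suc n)} {a}      {b}      a≢b f off = begin
  sum f                                               ≡⟨ sum-remove {i = a} f ⟩
  f a + sum (f ∘ punchIn a)                           ≡⟨ cong (λ e → f a + e) (sum-remove {i = b′} (f ∘ punchIn a)) ⟩
  f a + (f (punchIn a b′) + sum (f ∘ punchIn a ∘ punchIn b′))
    ≡⟨ cong₂ (λ u v → f a + (f u + v)) (FP.punchIn-punchOut a≢b) (sum-zero rest) ⟩
  f a + (f b + + 0)                                   ≡⟨ cong (λ e → f a + e) (ℤP.+-identityʳ (f b)) ⟩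
  f a + f b                                           ∎
  where
  open ≡-Reasoning
  b′ = punchOut a≢b
  rest : ∀ x → f (punchIn a (punchIn b′ x)) ≡ + 0
  rest x = off _ (FP.punchInᵢ≢i a _)
    (λ e → FP.punchInᵢ≢i b′ x (FP.punchIn-injective a _ _ (trans e (sym (FP.punchIn-punchOut a≢b)))))

x≡-x⇒x≡0 : ∀ (x : ℤ) → x ≡ - x → x ≡ + 0
x≡-x⇒x≡0 x x≡-x = ℤP.*-cancelˡ-≡ (+ 2) x (+ 0) (begin
  + 2 * x   ≡⟨ lemma x ⟩
  x + x     ≡⟨ cong (λ e → x + e) x≡-x ⟩
  x - x     ≡⟨ ℤP.+-inverseʳ x ⟩
  + 0       ∎)
  where
  open ≡-Reasoning
  lemma : ∀ x → + 2 * x ≡ x + x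
  lemma = solve-∀

detℤ-swapAdjacentCols : ∀ k {a b : Fin k} → Adjacent a b → (M N : Mat k) →
                        (∀ i → Transposed a b (N i) (M i)) → detℤ k N ≡ - detℤ k M
detℤ-swapAdjacentCols (suc k) {a} {b} adj M N N⇄M =
  inverseˡ-unique (detℤ (suc k) N) (detℤ (suc k) M) (begin
    detℤ (suc k) N + detℤ (suc k) M  ≡⟨ sym (∑-distrib-+ (term N) (term M)) ⟩
    sum (λ j → term N j + term M j)  ≡⟨ sum-supportedOnPair (Adjacent⇒≢ adj) _ off ⟩
    term N a + term M a + (term N b + term M b)
      ≡⟨ cong₂ (λ x y → x + term M a + (y + term M b)) termN-a termN-b ⟩
    sg a * (M F.zero b * db) + sg a * (M F.zero a * da) + (sg b * (M F.zero a * da) + sg b * (M F.zero b * db))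
      ≡⟨ cong (λ s → sg a * (M F.zero b * db) + sg a * (M F.zero a * da) + (s * (M F.zero a * da) + s * (M F.zero b * db)))
              (Adjacent-sg adj) ⟩
    sg a * (M F.zero b * db) + sg a * (M F.zero a * da) + (- sg a * (M F.zero a * da) + - sg a * (M F.zero b * db))
      ≡⟨ lemma (sg a) (M F.zero b * db) (M F.zero a * da) ⟩
    + 0 ∎)
  where
  open ≡-Reasoning
  lemma : ∀ s x y → s * x + s * y + (- s * y + - s * x) ≡ + 0
  lemma = solve-∀
  term : Mat (suc k) → Fin (suc k) → ℤ
  term X j = sg j * (X F.zero j * detℤ k (minor j X))
  da = detℤ k (minor a M)
  db = detℤ k (minor b M)
  termN-a : term N a ≡ sg a * (M F.zero b * db)
  termN-a = cong₂ (λ x d → sg a * (x * d)) (at₁ (N⇄M F.zero))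
                  (detℤ-cong k λ r → Transposed-punchIn adj (N⇄M (F.suc r)))
  termN-b : term N b ≡ sg b * (M F.zero a * da)
  termN-b = cong₂ (λ x d → sg b * (x * d)) (at₂ (N⇄M F.zero))
                  (detℤ-cong k λ r x → sym (Transposed-punchIn adj (Transposed-sym (N⇄M (F.suc r))) x))
  off : ∀ j → j ≢ a → j ≢ b → term N j + term M j ≡ + 0
  off j j≢a j≢b = begin
    sg j * (N F.zero j * detℤ k (minor j N)) + term M j
      ≡⟨ cong₂ (λ x d → sg j * (x * d) + term M j) (elsewhere (N⇄M F.zero) j≢a j≢b)
               (detℤ-swapAdjacentCols k (Adjacent-punchOut adj j≢a j≢b) (minor j M) (minor j N)
                                      (λ r → Transposed-punchOut j≢a j≢b (N⇄M (F.suc r)))) ⟩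
    sg j * (M F.zero j * - detℤ k (minor j M)) + sg j * (M F.zero j * detℤ k (minor j M))
      ≡⟨ cancel (sg j) (M F.zero j) (detℤ k (minor j M)) ⟩
    + 0 ∎
    where cancel : ∀ s x d → s * (x * - d) + s * (x * d) ≡ + 0
          cancel = solve-∀

punchIn-punchOut-comm : ∀ {k} {j i : Fin (suc (suc k))} (j≢i : j ≢ i) (i≢j : i ≢ j) (x : Fin k) →
                        punchIn j (punchIn (punchOut j≢i) x) ≡ punchIn i (punchIn (punchOut i≢j) x)
punchIn-punchOut-comm {j = F.zero}  {F.zero}  j≢i i≢j x = contradiction refl j≢i
punchIn-punchOut-comm {j = F.zero}  {F.suc i} j≢i i≢j x = refl
punchIn-punchOut-comm {j = F.suc j} {F.zero}  j≢i i≢j x = refl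
punchIn-punchOut-comm {suc k} {F.suc j} {F.suc i} j≢i i≢j F.zero    = refl
punchIn-punchOut-comm {suc k} {F.suc j} {F.suc i} j≢i i≢j (F.suc x) =
  cong F.suc (punchIn-punchOut-comm (j≢i ∘ cong F.suc) (i≢j ∘ cong F.suc) x)

sg-punchOut-anti : ∀ {k} {j i : Fin (suc (suc k))} (j≢i : j ≢ i) (i≢j : i ≢ j) →
                   sg j * sg (punchOut j≢i) ≡ - (sg i * sg (punchOut i≢j))
sg-punchOut-anti {j = F.zero}  {F.zero}  j≢i i≢j = contradiction refl j≢i
sg-punchOut-anti {j = F.zero}  {F.suc i} j≢i i≢j = lemma (sg i)
  where lemma : ∀ s → + 1 * s ≡ - (- s * + 1)
        lemma = solve-∀
sg-punchOut-anti {j = F.suc j} {F.zero}  j≢i i≢j = lemma (sg j)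
  where lemma : ∀ s → - s * + 1 ≡ - (+ 1 * s)
        lemma = solve-∀
sg-punchOut-anti {zero}  {F.suc F.zero} {F.suc F.zero} j≢i i≢j = contradiction refl j≢i
sg-punchOut-anti {suc k} {F.suc j}      {F.suc i}      j≢i i≢j = begin
  - sg j * - sg (punchOut (j≢i ∘ cong F.suc))    ≡⟨ lemma (sg j) _ ⟩
  sg j * sg (punchOut (j≢i ∘ cong F.suc))        ≡⟨ sg-punchOut-anti (j≢i ∘ cong F.suc) (i≢j ∘ cong F.suc) ⟩
  - (sg i * sg (punchOut (i≢j ∘ cong F.suc)))    ≡⟨ cong -_ (sym (lemma (sg i) _)) ⟩
  - (- sg i * - sg (punchOut (i≢j ∘ cong F.suc))) ∎
  where open ≡-Reasoning
        lemma : ∀ s t → - s * - t ≡ s * t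
        lemma = solve-∀

-- With E j c the complementary minors, expansion (M 0) (M 1) is detℤ M expanded along its first
-- two rows; reindexed by ordered pairs of columns, the terms for (j , i) and (i , j) cancel.
module SecondOrderExpansion {k} (E : Fin (suc (suc k)) → Fin (suc k) → ℤ)
  (E-sym : ∀ {j i} (j≢i : j ≢ i) (i≢j : i ≢ j) → E j (punchOut j≢i) ≡ E i (punchOut i≢j)) where

  expansion : (u w : Fin (suc (suc k)) → ℤ) → ℤ
  expansion u w = sum λ j → sg j * (u j * sum λ c → sg c * (w (punchIn j c) * E j c))

  private
    pair : (u w : Fin (suc (suc k)) → ℤ) (j i : Fin (suc (suc k))) → Dec (j ≡ i) → ℤ
    pair u w j i (yes _)  = + 0
    pair u w j i (no j≢i) = sg j * (u j * (sg (punchOut j≢i) * (w i * E j (punchOut j≢i))))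

    pair-anti : ∀ u w j i d d′ → pair u w j i d ≡ - pair w u i j d′
    pair-anti u w j i (yes _)    (yes _)    = refl
    pair-anti u w j i (yes j≡i)  (no i≢j)   = contradiction (sym j≡i) i≢j
    pair-anti u w j i (no j≢i)   (yes i≡j)  = contradiction (sym i≡j) j≢i
    pair-anti u w j i (no j≢i)   (no i≢j)   = begin
      sg j * (u j * (sg (punchOut j≢i) * (w i * E j (punchOut j≢i))))
        ≡⟨ regroup (sg j) (sg (punchOut j≢i)) (u j) (w i) _ ⟩
      (sg j * sg (punchOut j≢i)) * (w i * (u j * E j (punchOut j≢i)))
        ≡⟨ cong₂ (λ s e → s * (w i * (u j * e))) (sg-punchOut-anti j≢i i≢j) (E-sym j≢i i≢j) ⟩
      - (sg i * sg (punchOut i≢j)) * (w i * (u j * E i (punchOut i≢j)))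
        ≡⟨ regroup′ (sg i) (sg (punchOut i≢j)) (w i) (u j) _ ⟩
      - (sg i * (w i * (sg (punchOut i≢j) * (u j * E i (punchOut i≢j))))) ∎
      where
      open ≡-Reasoning
      regroup : ∀ s t x y e → s * (x * (t * (y * e))) ≡ (s * t) * (y * (x * e))
      regroup = solve-∀
      regroup′ : ∀ s t x y e → - (s * t) * (x * (y * e)) ≡ - (s * (x * (t * (y * e))))
      regroup′ = solve-∀

    row-as-pairs : ∀ u w j → sg j * (u j * sum λ c → sg c * (w (punchIn j c) * E j c)) ≡
                             sum λ i → pair u w j i (j F.≟ i)
    row-as-pairs u w j = begin
      sg j * (u j * sum λ c → sg c * (w (punchIn j c) * E j c))
        ≡⟨ cong (sg j *_) (*-distribˡ-sum (u j) (λ c → sg c * (w (punchIn j c) * E j c))) ⟩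
      sg j * sum (λ c → u j * (sg c * (w (punchIn j c) * E j c)))
        ≡⟨ *-distribˡ-sum (sg j) (λ c → u j * (sg c * (w (punchIn j c) * E j c))) ⟩
      sum (λ c → sg j * (u j * (sg c * (w (punchIn j c) * E j c))))
        ≡⟨ sum-cong-≗ (λ c → sym (pair-punchIn c)) ⟩
      sum (λ c → pair u w j (punchIn j c) (j F.≟ punchIn j c))
        ≡⟨ sym (ℤP.+-identityˡ (sum (λ c → pair u w j (punchIn j c) (j F.≟ punchIn j c)))) ⟩
      + 0 + sum (λ c → pair u w j (punchIn j c) (j F.≟ punchIn j c))
        ≡⟨ cong (λ e → e + sum (λ c → pair u w j (punchIn j c) (j F.≟ punchIn j c))) (sym (pair-diagonal (j F.≟ j))) ⟩
      pair u w j j (j F.≟ j) + sum (λ c → pair u w j (punchIn j c) (j F.≟ punchIn j c))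
        ≡⟨ sym (sum-remove {i = j} (λ i → pair u w j i (j F.≟ i))) ⟩
      sum (λ i → pair u w j i (j F.≟ i)) ∎
      where
      open ≡-Reasoning
      pair-diagonal : (d : Dec (j ≡ j)) → pair u w j j d ≡ + 0
      pair-diagonal (yes _)  = refl
      pair-diagonal (no j≢j) = contradiction refl j≢j
      pair-punchIn : ∀ c → pair u w j (punchIn j c) (j F.≟ punchIn j c) ≡ sg j * (u j * (sg c * (w (punchIn j c) * E j c)))
      pair-punchIn c with j F.≟ punchIn j c
      ... | yes j≡ = contradiction (sym j≡) (FP.punchInᵢ≢i j c)
      ... | no j≢ = cong (λ c′ → sg j * (u j * (sg c′ * (w (punchIn j c) * E j c′))))
                         (trans (FP.punchOut-cong j refl) (FP.punchOut-punchIn j))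

  expansion-anti : ∀ u w → expansion w u ≡ - expansion u w
  expansion-anti u w = begin
    expansion w u                                        ≡⟨ sum-cong-≗ (row-as-pairs w u) ⟩
    sum (λ j → sum λ i → pair w u j i (j F.≟ i))
      ≡⟨ sum-cong-≗ (λ j → sum-cong-≗ λ i → pair-anti w u j i (j F.≟ i) (i F.≟ j)) ⟩
    sum (λ j → sum λ i → - pair u w i j (i F.≟ j))
      ≡⟨ sum-cong-≗ (λ j → sum-neg (λ i → pair u w i j (i F.≟ j))) ⟩
    sum (λ j → - sum λ i → pair u w i j (i F.≟ j))       ≡⟨ sum-neg (λ j → sum λ i → pair u w i j (i F.≟ j)) ⟩
    - sum (λ j → sum λ i → pair u w i j (i F.≟ j))       ≡⟨ cong -_ (∑-comm (λ j i → pair u w i j (i F.≟ j))) ⟩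
    - sum (λ i → sum λ j → pair u w i j (i F.≟ j))       ≡⟨ cong -_ (sym (sum-cong-≗ (row-as-pairs u w))) ⟩
    - expansion u w                                      ∎
    where open ≡-Reasoning

rows01Swapped : ∀ {k} → Mat (suc (suc k)) → Mat (suc (suc k))
rows01Swapped M F.zero               = M (F.suc F.zero)
rows01Swapped M (F.suc F.zero)       = M F.zero
rows01Swapped M (F.suc (F.suc r))    = M (F.suc (F.suc r))

detℤ-swapRows01 : ∀ k (M : Mat (suc (suc k))) → detℤ (suc (suc k)) (rows01Swapped M) ≡ - detℤ (suc (suc k)) M
detℤ-swapRows01 k M = SecondOrderExpansion.expansion-anti E E-sym (M F.zero) (M (F.suc F.zero))
  where
  E : Fin (suc (suc k)) → Fin (suc k) → ℤ
  E j c = detℤ k (minor c (minor j M))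
  E-sym : ∀ {j i} (j≢i : j ≢ i) (i≢j : i ≢ j) → E j (punchOut j≢i) ≡ E i (punchOut i≢j)
  E-sym j≢i i≢j = detℤ-cong k λ r x → cong (M (F.suc (F.suc r))) (punchIn-punchOut-comm j≢i i≢j x)

detℤ-swapAdjacentRows : ∀ k {a b : Fin k} → Adjacent a b → (M N : Mat k) →
                        (∀ j → Transposed a b (λ i → N i j) (λ i → M i j)) → detℤ k N ≡ - detℤ k M
detℤ-swapAdjacentRows (suc (suc k)) adjacent₀ M N N⇄M =
  trans (detℤ-cong (suc (suc k)) rows) (detℤ-swapRows01 k M)
  where
  rows : ∀ i j → N i j ≡ rows01Swapped M i j
  rows F.zero               j = at₁ (N⇄M j)
  rows (F.suc F.zero)       j = at₂ (N⇄M j)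
  rows (F.suc (F.suc r))    j = elsewhere (N⇄M j) (λ ()) (λ ())
detℤ-swapAdjacentRows (suc k) (adjacentₛ adj) M N N⇄M =
  trans (sum-cong-≗ term) (sum-neg λ j → sg j * (M F.zero j * detℤ k (minor j M)))
  where
  term : ∀ j → sg j * (N F.zero j * detℤ k (minor j N)) ≡ - (sg j * (M F.zero j * detℤ k (minor j M)))
  term j = trans
    (cong₂ (λ x d → sg j * (x * d)) (elsewhere (N⇄M j) (λ ()) (λ ()))
           (detℤ-swapAdjacentRows k adj (minor j M) (minor j N) λ c → record
              { at₁ = at₁ (N⇄M (punchIn j c)) ; at₂ = at₂ (N⇄M (punchIn j c))
              ; elsewhere = λ r≢a r≢b → elsewhere (N⇄M (punchIn j c)) (r≢a ∘ FP.suc-injective) (r≢b ∘ FP.suc-injective) }))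
    (lemma (sg j) (M F.zero j) (detℤ k (minor j M)))
    where lemma : ∀ s x d → s * (x * - d) ≡ - (s * (x * d))
          lemma = solve-∀

detℤ-equalAdjacentCols : ∀ k {a b : Fin k} → Adjacent a b → (M : Mat k) → (∀ i → M i a ≡ M i b) → detℤ k M ≡ + 0
detℤ-equalAdjacentCols k adj M a≡b = x≡-x⇒x≡0 _ (detℤ-swapAdjacentCols k adj M M λ i → record
  { at₁ = a≡b i ; at₂ = sym (a≡b i) ; elsewhere = λ _ _ → refl })

detℤ-equalAdjacentRows : ∀ k {a b : Fin k} → Adjacent a b → (M : Mat k) → (∀ j → M a j ≡ M b j) → detℤ k M ≡ + 0
detℤ-equalAdjacentRows k adj M a≡b = x≡-x⇒x≡0 _ (detℤ-swapAdjacentRows k adj M M λ j → record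
  { at₁ = a≡b j ; at₂ = sym (a≡b j) ; elsewhere = λ _ _ → refl })

toFront : ∀ {n} → Fin (suc n) → Fin (suc n) → Fin (suc n)
toFront v F.zero    = v
toFront v (F.suc i) = punchIn v i

toFront-zero : ∀ {n} (x : Fin (suc n)) → toFront F.zero x ≡ x
toFront-zero F.zero    = refl
toFront-zero (F.suc x) = refl

sum-toFront : ∀ {k} (v : Fin (suc k)) (f : Fin (suc k) → ℤ) → sum (f ∘ toFront v) ≡ sum f
sum-toFront v f = sym (sum-remove {i = v} f)

swapAdjacent : ∀ {n} → Fin n → Fin (suc n) → Fin (suc n)
swapAdjacent F.zero    F.zero                = F.suc F.zero
swapAdjacent F.zero    (F.suc F.zero)        = F.zero
swapAdjacent F.zero    (F.suc (F.suc x))     = F.suc (F.suc x)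
swapAdjacent (F.suc w) F.zero                = F.zero
swapAdjacent (F.suc w) (F.suc x)             = F.suc (swapAdjacent w x)

swapAdjacent-transposes : ∀ {n} (w : Fin n) (u : Fin (suc n) → ℤ) → Transposed (F.inject₁ w) (F.suc w) (u ∘ swapAdjacent w) u
swapAdjacent-transposes F.zero    u = record
  { at₁ = refl ; at₂ = refl ; elsewhere = λ { {F.zero} j≢a _ → contradiction refl j≢a
                                             ; {F.suc F.zero} _ j≢b → contradiction refl j≢b
                                             ; {F.suc (F.suc j)} _ _ → refl } }
swapAdjacent-transposes (F.suc w) u = record
  { at₁ = at₁ tail ; at₂ = at₂ tail
  ; elsewhere = λ { {F.zero} _ _ → refl
                  ; {F.suc j} j≢a j≢b → elsewhere tail (j≢a ∘ cong F.suc) (j≢b ∘ cong F.suc) } }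
  where tail = swapAdjacent-transposes w (u ∘ F.suc)

swapAdjacent-toFront : ∀ {n} (w : Fin n) x → swapAdjacent w (toFront (F.inject₁ w) x) ≡ toFront (F.suc w) x
swapAdjacent-toFront w F.zero = at-inject₁ w
  where at-inject₁ : ∀ {n} (w : Fin n) → swapAdjacent w (F.inject₁ w) ≡ F.suc w
        at-inject₁ F.zero    = refl
        at-inject₁ (F.suc w) = cong F.suc (at-inject₁ w)
swapAdjacent-toFront w (F.suc y) = punchIns w y
  where punchIns : ∀ {n} (w y : Fin n) → swapAdjacent w (punchIn (F.inject₁ w) y) ≡ punchIn (F.suc w) y
        punchIns F.zero    F.zero    = refl
        punchIns F.zero    (F.suc y) = refl
        punchIns (F.suc w) F.zero    = refl
        punchIns (F.suc w) (F.suc y) = cong F.suc (punchIns w y)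

sg-inject₁*-d : ∀ {n} (w : Fin n) d → sg (F.inject₁ w) * - d ≡ sg (F.suc w) * d
sg-inject₁*-d w d = begin
  sg (F.inject₁ w) * - d     ≡⟨ sym (ℤP.neg-distribʳ-* (sg (F.inject₁ w)) d) ⟩
  - (sg (F.inject₁ w) * d)   ≡⟨ ℤP.neg-distribˡ-* (sg (F.inject₁ w)) d ⟩
  - sg (F.inject₁ w) * d     ≡⟨ cong (λ t → - sgn t * d) (FP.toℕ-inject₁ w) ⟩
  sg (F.suc w) * d           ∎
  where open ≡-Reasoning

detℤ-colToFront : ∀ k (v : Fin (suc k)) (M : Mat (suc k)) →
                  detℤ (suc k) (λ i x → M i (toFront v x)) ≡ sg v * detℤ (suc k) M
detℤ-colToFront k = <-weakInduction _ base step
  where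
  base : ∀ M → detℤ (suc k) (λ i x → M i (toFront F.zero x)) ≡ + 1 * detℤ (suc k) M
  base M = trans (detℤ-cong (suc k) λ i x → cong (M i) (toFront-zero x)) (sym (ℤP.*-identityˡ (detℤ (suc k) M)))
  step : ∀ w → (∀ M → detℤ (suc k) (λ i x → M i (toFront (F.inject₁ w) x)) ≡ sg (F.inject₁ w) * detℤ (suc k) M) →
               ∀ M → detℤ (suc k) (λ i x → M i (toFront (F.suc w) x)) ≡ sg (F.suc w) * detℤ (suc k) M
  step w ih M = begin
    detℤ (suc k) (λ i x → M i (toFront (F.suc w) x))
      ≡⟨ detℤ-cong (suc k) (λ i x → cong (M i) (sym (swapAdjacent-toFront w x))) ⟩
    detℤ (suc k) (λ i x → M i (swapAdjacent w (toFront (F.inject₁ w) x)))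
      ≡⟨ ih (λ i → M i ∘ swapAdjacent w) ⟩
    sg (F.inject₁ w) * detℤ (suc k) (λ i → M i ∘ swapAdjacent w)
      ≡⟨ cong (sg (F.inject₁ w) *_) (detℤ-swapAdjacentCols (suc k) (Adjacent-inject₁ w) M _
                                                           (λ i → swapAdjacent-transposes w (M i))) ⟩
    sg (F.inject₁ w) * - detℤ (suc k) M
      ≡⟨ sg-inject₁*-d w (detℤ (suc k) M) ⟩
    sg (F.suc w) * detℤ (suc k) M ∎
    where open ≡-Reasoning

detℤ-rowToFront : ∀ k (v : Fin (suc k)) (M : Mat (suc k)) →
                  detℤ (suc k) (λ x j → M (toFront v x) j) ≡ sg v * detℤ (suc k) M
detℤ-rowToFront k = <-weakInduction _ base step
  where
  base : ∀ M → detℤ (suc k) (λ x j → M (toFront F.zero x) j) ≡ + 1 * detℤ (suc k) M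
  base M = trans (detℤ-cong (suc k) λ x j → cong (λ y → M y j) (toFront-zero x)) (sym (ℤP.*-identityˡ (detℤ (suc k) M)))
  step : ∀ w → (∀ M → detℤ (suc k) (λ x j → M (toFront (F.inject₁ w) x) j) ≡ sg (F.inject₁ w) * detℤ (suc k) M) →
               ∀ M → detℤ (suc k) (λ x j → M (toFront (F.suc w) x) j) ≡ sg (F.suc w) * detℤ (suc k) M
  step w ih M = begin
    detℤ (suc k) (λ x j → M (toFront (F.suc w) x) j)
      ≡⟨ detℤ-cong (suc k) (λ x j → cong (λ y → M y j) (sym (swapAdjacent-toFront w x))) ⟩
    detℤ (suc k) (λ x j → M (swapAdjacent w (toFront (F.inject₁ w) x)) j)
      ≡⟨ ih (M ∘ swapAdjacent w) ⟩
    sg (F.inject₁ w) * detℤ (suc k) (M ∘ swapAdjacent w)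
      ≡⟨ cong (sg (F.inject₁ w) *_) (detℤ-swapAdjacentRows (suc k) (Adjacent-inject₁ w) M _
                                                           (λ j → swapAdjacent-transposes w (λ i → M i j))) ⟩
    sg (F.inject₁ w) * - detℤ (suc k) M
      ≡⟨ sg-inject₁*-d w (detℤ (suc k) M) ⟩
    sg (F.suc w) * detℤ (suc k) M ∎
    where open ≡-Reasoning

sg*sg≡1 : ∀ {n} (v : Fin n) → sg v * sg v ≡ + 1
sg*sg≡1 v = go (toℕ v)
  where go : ∀ t → sgn t * sgn t ≡ + 1
        go zero    = refl
        go (suc t) = trans (lemma (sgn t)) (go t)
          where lemma : ∀ s → - s * - s ≡ s * s
                lemma = solve-∀

sg*x≡0⇒x≡0 : ∀ {n} (v : Fin n) {x} → sg v * x ≡ + 0 → x ≡ + 0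
sg*x≡0⇒x≡0 v {x} eq = begin
  x                  ≡⟨ sym (ℤP.*-identityˡ x) ⟩
  + 1 * x            ≡⟨ cong (_* x) (sym (sg*sg≡1 v)) ⟩
  sg v * sg v * x    ≡⟨ ℤP.*-assoc (sg v) (sg v) x ⟩
  sg v * (sg v * x)  ≡⟨ cong (sg v *_) eq ⟩
  sg v * + 0         ≡⟨ ℤP.*-zeroʳ (sg v) ⟩
  + 0                ∎
  where open ≡-Reasoning

detℤ-conjugateToFront : ∀ k (v : Fin (suc k)) (M : Mat (suc k)) →
                        detℤ (suc k) (λ i j → M (toFront v i) (toFront v j)) ≡ detℤ (suc k) M
detℤ-conjugateToFront k v M = begin
  detℤ (suc k) (λ i j → M (toFront v i) (toFront v j))  ≡⟨ detℤ-rowToFront k v (λ i j → M i (toFront v j)) ⟩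
  sg v * detℤ (suc k) (λ i j → M i (toFront v j))       ≡⟨ cong (sg v *_) (detℤ-colToFront k v M) ⟩
  sg v * (sg v * detℤ (suc k) M)                         ≡⟨ sym (ℤP.*-assoc (sg v) (sg v) _) ⟩
  sg v * sg v * detℤ (suc k) M                           ≡⟨ cong (_* detℤ (suc k) M) (sg*sg≡1 v) ⟩
  + 1 * detℤ (suc k) M                                   ≡⟨ ℤP.*-identityˡ _ ⟩
  detℤ (suc k) M                                         ∎
  where open ≡-Reasoning

detℤ-equalCols : ∀ k (M : Mat (suc k)) (c : Fin k) → (∀ i → M i F.zero ≡ M i (F.suc c)) → detℤ (suc k) M ≡ + 0
detℤ-equalCols (suc k) M c eq = sg*x≡0⇒x≡0 (F.suc c) (trans (sym (detℤ-colToFront (suc k) (F.suc c) M))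
  (detℤ-equalAdjacentCols (suc (suc k)) adjacent₀ (λ i x → M i (toFront (F.suc c) x)) (λ i → sym (eq i))))

detℤ-equalRows : ∀ k (M : Mat (suc k)) (c : Fin k) → (∀ j → M F.zero j ≡ M (F.suc c) j) → detℤ (suc k) M ≡ + 0
detℤ-equalRows (suc k) M c eq = sg*x≡0⇒x≡0 (F.suc c) (trans (sym (detℤ-rowToFront (suc k) (F.suc c) M))
  (detℤ-equalAdjacentRows (suc (suc k)) adjacent₀ (λ x j → M (toFront (F.suc c) x) j) (λ j → sym (eq j))))

setRow0 : ∀ {k} → (Fin (suc k) → ℤ) → Mat (suc k) → Mat (suc k)
setRow0 w M F.zero    j = w j
setRow0 w M (F.suc i) j = M (F.suc i) j

setCol0 : ∀ {k} → (Fin (suc k) → ℤ) → Mat (suc k) → Mat (suc k)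
setCol0 w M i F.zero    = w i
setCol0 w M i (F.suc j) = M i (F.suc j)

detℤ-colSumsInRow0 : ∀ k (M : Mat (suc k)) → detℤ (suc k) (setRow0 (λ j → sum λ i → M i j) M) ≡ detℤ (suc k) M
detℤ-colSumsInRow0 k M = begin
  sum (λ j → sg j * (sum (λ i → M i j) * d j))
    ≡⟨ sum-cong-≗ (λ j → trans (cong (sg j *_) (*-distribʳ-sum (d j) (λ i → M i j)))
                               (*-distribˡ-sum (sg j) (λ i → M i j * d j))) ⟩
  sum (λ j → sum λ i → sg j * (M i j * d j))
    ≡⟨ ∑-comm (λ j i → sg j * (M i j * d j)) ⟩
  sum (λ i → sum λ j → sg j * (M i j * d j))
    ≡⟨ cong (λ e → detℤ (suc k) M + e) (sum-zero λ i → detℤ-equalRows k (setRow0 (M (F.suc i)) M) i (λ j → refl)) ⟩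
  detℤ (suc k) M + + 0
    ≡⟨ ℤP.+-identityʳ _ ⟩
  detℤ (suc k) M ∎
  where
  open ≡-Reasoning
  d : Fin (suc k) → ℤ
  d j = detℤ k (minor j M)

detℤ-col0-sum : ∀ k (M : Mat (suc k)) t (g : Fin t → Fin (suc k) → ℤ) →
                detℤ (suc k) (setCol0 (λ i → sum λ s → g s i) M) ≡ sum λ s → detℤ (suc k) (setCol0 (g s) M)
detℤ-col0-sum k M zero g =
  trans (detℤ-linearInCol (suc k) F.zero (+ 0) (+ 0) (setCol0 (λ _ → + 0) M) M M
                          (λ i → sym (0x+0y (M i F.zero) (M i F.zero))) off off)
        (0x+0y (detℤ (suc k) M) (detℤ (suc k) M))
  where
  0x+0y : ∀ x y → + 0 * x + + 0 * y ≡ + 0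
  0x+0y = solve-∀
  off : ∀ i j → j ≢ F.zero → setCol0 (λ _ → + 0) M i j ≡ M i j
  off i F.zero    j≢0 = contradiction refl j≢0
  off i (F.suc j) j≢0 = refl
detℤ-col0-sum k M (suc t) g =
  trans (detℤ-linearInCol (suc k) F.zero (+ 1) (+ 1) (setCol0 (λ i → g F.zero i + rest i) M)
                          (setCol0 (g F.zero) M) (setCol0 rest M) (λ i → sym (1x+1y (g F.zero i) (rest i))) off off)
        (trans (1x+1y (detℤ (suc k) (setCol0 (g F.zero) M)) (detℤ (suc k) (setCol0 rest M)))
               (cong (λ e → detℤ (suc k) (setCol0 (g F.zero) M) + e) (detℤ-col0-sum k M t (g ∘ F.suc))))
  where
  1x+1y : ∀ x y → + 1 * x + + 1 * y ≡ x + y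
  1x+1y = solve-∀
  rest : Fin (suc k) → ℤ
  rest i = sum λ s → g (F.suc s) i
  off : ∀ {w w′} i j → j ≢ F.zero → setCol0 w M i j ≡ setCol0 w′ M i j
  off i F.zero    j≢0 = contradiction refl j≢0
  off i (F.suc j) j≢0 = refl

detℤ-rowSumsInCol0 : ∀ k (M : Mat (suc k)) → detℤ (suc k) (setCol0 (λ i → sum (M i)) M) ≡ detℤ (suc k) M
detℤ-rowSumsInCol0 k M = begin
  detℤ (suc k) (setCol0 (λ i → sum (M i)) M)
    ≡⟨ detℤ-col0-sum k M (suc k) (λ j i → M i j) ⟩
  detℤ (suc k) (setCol0 (λ i → M i F.zero) M) + sum (λ c → detℤ (suc k) (setCol0 (λ i → M i (F.suc c)) M))
    ≡⟨ cong₂ _+_ (detℤ-cong (suc k) {setCol0 (λ i → M i F.zero) M} {M} λ { i F.zero → refl ; i (F.suc j) → refl })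
                 (sum-zero λ c → detℤ-equalCols k (setCol0 (λ i → M i (F.suc c)) M) c (λ i → refl)) ⟩
  detℤ (suc k) M + + 0
    ≡⟨ ℤP.+-identityʳ _ ⟩
  detℤ (suc k) M ∎
  where open ≡-Reasoning

detℤ-addToCol : ∀ k (c : Fin k) (t : ℤ) (M N : Mat (suc k)) →
                (∀ i → N i (F.suc c) ≡ M i (F.suc c) + t * M i F.zero) →
                (∀ i j → j ≢ F.suc c → N i j ≡ M i j) → detℤ (suc k) N ≡ detℤ (suc k) M
detℤ-addToCol k c t M N atc off = begin
  detℤ (suc k) N                                ≡⟨ detℤ-linearInCol (suc k) (F.suc c) (+ 1) t N M X atc′ off off′ ⟩
  + 1 * detℤ (suc k) M + t * detℤ (suc k) X      ≡⟨ cong (λ e → + 1 * detℤ (suc k) M + t * e) X-singular ⟩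
  + 1 * detℤ (suc k) M + t * + 0                 ≡⟨ lemma (detℤ (suc k) M) t ⟩
  detℤ (suc k) M                                ∎
  where
  open ≡-Reasoning
  lemma : ∀ d t → + 1 * d + t * + 0 ≡ d
  lemma = solve-∀
  X : Mat (suc k)
  X i = updateAt (M i) (F.suc c) (λ _ → M i F.zero)
  atc′ : ∀ i → N i (F.suc c) ≡ + 1 * M i (F.suc c) + t * X i (F.suc c)
  atc′ i = trans (atc i) (cong₂ (λ x y → x + t * y) (sym (ℤP.*-identityˡ (M i (F.suc c))))
                                                     (sym (updateAt-updates (F.suc c) {λ _ → M i F.zero} (M i))))
  off′ : ∀ i j → j ≢ F.suc c → N i j ≡ X i j
  off′ i j j≢c = trans (off i j j≢c) (sym (updateAt-minimal j (F.suc c) {λ _ → M i F.zero} (M i) j≢c))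
  X-singular : detℤ (suc k) X ≡ + 0
  X-singular = detℤ-equalCols k X c λ i → trans (updateAt-minimal F.zero (F.suc c) {λ _ → M i F.zero} (M i) (λ ()))
                                                (sym (updateAt-updates (F.suc c) {λ _ → M i F.zero} (M i)))

addToCols : ∀ {k} → (Fin k → ℤ) → Mat (suc k) → Mat (suc k)
addToCols θ M i F.zero    = M i F.zero
addToCols θ M i (F.suc j) = M i (F.suc j) + θ j * M i F.zero

detℤ-addToCols : ∀ k (θ : Fin k → ℤ) (M : Mat (suc k)) → detℤ (suc k) (addToCols θ M) ≡ detℤ (suc k) M
detℤ-addToCols k θ M = supportedBelow k θ (λ j k≤j → contradiction (FP.toℕ<n j) (ℕP.≤⇒≯ k≤j))
  where
  supportedBelow : ∀ t (θ : Fin k → ℤ) → (∀ j → t ≤ toℕ j → θ j ≡ + 0) →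
                   detℤ (suc k) (addToCols θ M) ≡ detℤ (suc k) M
  supportedBelow zero θ θ≡0 = detℤ-cong (suc k) {addToCols θ M} {M} λ
    { i F.zero    → refl
    ; i (F.suc j) → trans (cong (λ x → M i (F.suc j) + x * M i F.zero) (θ≡0 j ℕ.z≤n)) (lemma (M i (F.suc j)) (M i F.zero)) }
    where lemma : ∀ x y → x + + 0 * y ≡ x
          lemma = solve-∀
  supportedBelow (suc t) θ θ≡0 with t ℕP.<? k
  ... | no  t≮k = supportedBelow t θ λ j t≤j →
                    contradiction (ℕP.<-≤-trans (FP.toℕ<n j) (ℕP.≮⇒≥ t≮k)) (ℕP.≤⇒≯ t≤j)
  ... | yes t<k = trans (detℤ-addToCol k c (θ c) (addToCols θ′ M) (addToCols θ M) atc off)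
                        (supportedBelow t θ′ θ′≡0)
    where
    c = F.fromℕ< t<k
    θ′ = updateAt θ c (λ _ → + 0)
    θ′≡0 : ∀ j → t ≤ toℕ j → θ′ j ≡ + 0
    θ′≡0 j t≤j with j F.≟ c
    ... | yes refl = updateAt-updates c {λ _ → + 0} θ
    ... | no  j≢c  = trans (updateAt-minimal j c {λ _ → + 0} θ j≢c)
                           (θ≡0 j (ℕP.≤∧≢⇒< t≤j λ t≡j →
                             j≢c (FP.toℕ-injective (trans (sym t≡j) (sym (FP.toℕ-fromℕ< t<k))))))
    atc : ∀ i → addToCols θ M i (F.suc c) ≡ addToCols θ′ M i (F.suc c) + θ c * M i F.zero
    atc i = trans (lemma (M i (F.suc c)) (θ c) (M i F.zero))
                  (cong (λ x → M i (F.suc c) + x * M i F.zero + θ c * M i F.zero) (sym (updateAt-updates c {λ _ → + 0} θ)))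
      where lemma : ∀ x s y → x + s * y ≡ x + + 0 * y + s * y
            lemma = solve-∀
    off : ∀ i j → j ≢ F.suc c → addToCols θ M i j ≡ addToCols θ′ M i j
    off i F.zero    _   = refl
    off i (F.suc j) j≢c = cong (λ x → M i (F.suc j) + x * M i F.zero)
                               (sym (updateAt-minimal j c {λ _ → + 0} θ (j≢c ∘ cong F.suc)))

detℤ-scale : ∀ k (c : ℤ) (M : Mat k) → detℤ k (λ i j → c * M i j) ≡ c ℤ.^ k * detℤ k M
detℤ-scale zero    c M = refl
detℤ-scale (suc k) c M = begin
  sum (λ j → sg j * (c * M F.zero j * detℤ k (λ r x → c * minor j M r x)))
    ≡⟨ sum-cong-≗ (λ j → cong (λ d → sg j * (c * M F.zero j * d)) (detℤ-scale k c (minor j M))) ⟩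
  sum (λ j → sg j * (c * M F.zero j * (c ℤ.^ k * detℤ k (minor j M))))
    ≡⟨ sum-cong-≗ (λ j → lemma (sg j) c (M F.zero j) (c ℤ.^ k) (detℤ k (minor j M))) ⟩
  sum (λ j → c * c ℤ.^ k * (sg j * (M F.zero j * detℤ k (minor j M))))
    ≡⟨ sym (*-distribˡ-sum (c * c ℤ.^ k) (λ j → sg j * (M F.zero j * detℤ k (minor j M)))) ⟩
  c * c ℤ.^ k * detℤ (suc k) M ∎
  where
  open ≡-Reasoning
  lemma : ∀ s c a p d → s * (c * a * (p * d)) ≡ c * p * (s * (a * d))
  lemma = solve-∀

-- Matrices with constant line sums

border : ∀ {m} → ℤ → (Fin m → ℤ) → (Fin m → ℤ) → Mat m → Mat (suc m)
border a r c M F.zero    F.zero    = a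
border a r c M F.zero    (F.suc j) = r j
border a r c M (F.suc i) F.zero    = c i
border a r c M (F.suc i) (F.suc j) = M i j

detℤ-border-zeroRow : ∀ m a c (M : Mat m) → detℤ (suc m) (border a (λ _ → + 0) c M) ≡ a * detℤ m M
detℤ-border-zeroRow m a c M = begin
  + 1 * (a * detℤ m M) + sum (λ j → sg (F.suc j) * (+ 0 * detℤ m (minor (F.suc j) X)))
    ≡⟨ cong₂ _+_ (ℤP.*-identityˡ (a * detℤ m M))
                 (sum-zero {f = λ j → sg (F.suc j) * (+ 0 * detℤ m (minor (F.suc j) X))} λ j → ℤP.*-zeroʳ (sg (F.suc j))) ⟩
  a * detℤ m M + + 0
    ≡⟨ ℤP.+-identityʳ (a * detℤ m M) ⟩
  a * detℤ m M ∎
  where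
  open ≡-Reasoning
  X = border a (λ _ → + 0) c M

-- This is −1ᵀ adj(M) 1, so that detℤ-+J is the matrix determinant lemma for M + J.
borderCofactorSum : ∀ {m} → Mat m → ℤ
borderCofactorSum {m} M = sum λ j → sg (F.suc j) * detℤ m (minor (F.suc j) (border (+ 1) (λ _ → + 0) (λ _ → + 1) M))

borderCofactor-cong : ∀ {m} (M : Mat m) (X : Mat (suc m)) →
                      (∀ r → X (F.suc r) F.zero ≡ + 1) → (∀ r c → X (F.suc r) (F.suc c) ≡ M r c) →
                      ∀ j → detℤ m (minor (F.suc j) X) ≡
                            detℤ m (minor (F.suc j) (border (+ 1) (λ _ → + 0) (λ _ → + 1) M))
borderCofactor-cong {m} M X col0 rest j = detℤ-cong m λ
  { r F.zero    → col0 r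
  ; r (F.suc c) → rest r (punchIn j c) }

detℤ-+J : ∀ m (M : Mat m) → detℤ m (λ i j → M i j + + 1) ≡ detℤ m M - borderCofactorSum M
detℤ-+J m M = begin
  detℤ m (λ i j → M i j + + 1)               ≡⟨ sym (ℤP.*-identityˡ (detℤ m (λ i j → M i j + + 1))) ⟩
  + 1 * detℤ m (λ i j → M i j + + 1)         ≡⟨ sym (detℤ-border-zeroRow m (+ 1) (λ _ → + 1) (λ i j → M i j + + 1)) ⟩
  detℤ (suc m) (border (+ 1) (λ _ → + 0) (λ _ → + 1) (λ i j → M i j + + 1))
    ≡⟨ detℤ-cong (suc m) cleared ⟩
  detℤ (suc m) (addToCols (λ _ → + 1) R)     ≡⟨ detℤ-addToCols m (λ _ → + 1) R ⟩
  detℤ (suc m) R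
    ≡⟨ cong₂ _+_ (trans (ℤP.*-identityˡ (+ 1 * detℤ m M)) (ℤP.*-identityˡ (detℤ m M))) R-rest ⟩
  detℤ m M - borderCofactorSum M             ∎
  where
  open ≡-Reasoning
  R : Mat (suc m)
  R = border (+ 1) (λ _ → - (+ 1)) (λ _ → + 1) M
  cleared : ∀ i j → border (+ 1) (λ _ → + 0) (λ _ → + 1) (λ i j → M i j + + 1) i j ≡ addToCols (λ _ → + 1) R i j
  cleared F.zero    F.zero    = refl
  cleared F.zero    (F.suc j) = refl
  cleared (F.suc i) F.zero    = refl
  cleared (F.suc i) (F.suc j) = refl
  lemma : ∀ σ d → σ * (- (+ 1) * d) ≡ - (σ * d)
  lemma = solve-∀
  R-rest : sum (λ j → sg (F.suc j) * (- (+ 1) * detℤ m (minor (F.suc j) R))) ≡ - borderCofactorSum M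
  R-rest = trans (sum-cong-≗ λ j → trans (cong (λ d → sg (F.suc j) * (- (+ 1) * d))
                                                 (borderCofactor-cong M R (λ _ → refl) (λ _ _ → refl) j))
                                           (lemma (sg (F.suc j)) _))
                 (sum-neg λ j → sg (F.suc j) * detℤ m (minor (F.suc j) (border (+ 1) (λ _ → + 0) (λ _ → + 1) M)))

detℤ-constantRowSums : ∀ m (P : Mat (suc m)) (s : ℤ) → (∀ i → sum (P i) ≡ s) →
                       detℤ (suc m) P ≡ s * detℤ (suc m) (setCol0 (λ _ → + 1) P)
detℤ-constantRowSums m P s rowSums = begin
  detℤ (suc m) P                                   ≡⟨ sym (detℤ-rowSumsInCol0 m P) ⟩
  detℤ (suc m) (setCol0 (λ i → sum (P i)) P)
    ≡⟨ detℤ-linearInCol (suc m) F.zero s (+ 0) (setCol0 (λ i → sum (P i)) P) Q Q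
                        (λ i → trans (rowSums i) (lemma s)) off off ⟩
  s * detℤ (suc m) Q + + 0 * detℤ (suc m) Q        ≡⟨ lemma′ s (detℤ (suc m) Q) ⟩
  s * detℤ (suc m) Q                               ∎
  where
  open ≡-Reasoning
  Q = setCol0 (λ _ → + 1) P
  lemma : ∀ s → s ≡ s * + 1 + + 0 * + 1
  lemma = solve-∀
  lemma′ : ∀ s d → s * d + + 0 * d ≡ s * d
  lemma′ = solve-∀
  off : ∀ i j → j ≢ F.zero → setCol0 (λ i → sum (P i)) P i j ≡ Q i j
  off i F.zero    j≢0 = contradiction refl j≢0
  off i (F.suc j) j≢0 = refl

detℤ-onesCol0 : ∀ m (P : Mat (suc m)) (s : ℤ) → (∀ j → sum (λ i → P i (F.suc j)) ≡ s) →
                detℤ (suc m) (setCol0 (λ _ → + 1) P) ≡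
                + suc m * detℤ m (minor F.zero P) + s * borderCofactorSum (minor F.zero P)
detℤ-onesCol0 m P s colSums = begin
  detℤ (suc m) Q                                         ≡⟨ sym (detℤ-colSumsInRow0 m Q) ⟩
  + 1 * (sum {suc m} (λ _ → + 1) * detℤ m M) +
  sum (λ j → sg (F.suc j) * (sum (λ i → P i (F.suc j)) * detℤ m (minor (F.suc j) Q)))
    ≡⟨ cong₂ _+_ (trans (ℤP.*-identityˡ (sum {suc m} (λ _ → + 1) * detℤ m M))
                        (cong (_* detℤ m M) (trans (sum-const (suc m) (+ 1)) (ℤP.*-identityʳ (+ suc m)))))
                 (sum-cong-≗ λ j → trans (cong₂ (λ e d → sg (F.suc j) * (e * d)) (colSums j)
                                                (borderCofactor-cong M Q (λ _ → refl) (λ _ _ → refl) j))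
                                        (lemma (sg (F.suc j)) s _)) ⟩
  + suc m * detℤ m M + sum (λ j → s * (sg (F.suc j) * detℤ m (minor (F.suc j) B)))
    ≡⟨ cong (λ e → + suc m * detℤ m M + e) (sym (*-distribˡ-sum s λ j → sg (F.suc j) * detℤ m (minor (F.suc j) B))) ⟩
  + suc m * detℤ m M + s * borderCofactorSum M           ∎
  where
  open ≡-Reasoning
  M = minor F.zero P
  Q = setCol0 (λ _ → + 1) P
  B = border (+ 1) (λ _ → + 0) (λ _ → + 1) M
  lemma : ∀ σ s d → σ * (s * d) ≡ s * (σ * d)
  lemma = solve-∀

constantLineSums⇒detℤ-minor+J : ∀ m (P : Mat (suc m)) (s : ℤ) →
  (∀ i → sum (P i) ≡ s) → (∀ j → sum (λ i → P i j) ≡ s) →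
  s * s * detℤ m (λ i j → P (F.suc i) (F.suc j) + + 1) ≡ s * (s + + suc m) * detℤ m (minor F.zero P) - detℤ (suc m) P
constantLineSums⇒detℤ-minor+J m P s rowSums colSums = begin
  s * s * detℤ m (λ i j → M i j + + 1)                ≡⟨ cong (s * s *_) (detℤ-+J m M) ⟩
  s * s * (detℤ m M - T)                              ≡⟨ lemma s (+ suc m) (detℤ m M) T ⟩
  s * (s + + suc m) * detℤ m M - s * (+ suc m * detℤ m M + s * T)
    ≡⟨ cong (λ e → s * (s + + suc m) * detℤ m M - s * e) (sym (detℤ-onesCol0 m P s (colSums ∘ F.suc))) ⟩
  s * (s + + suc m) * detℤ m M - s * detℤ (suc m) (setCol0 (λ _ → + 1) P)
    ≡⟨ cong (λ e → s * (s + + suc m) * detℤ m M - e) (sym (detℤ-constantRowSums m P s rowSums)) ⟩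
  s * (s + + suc m) * detℤ m M - detℤ (suc m) P       ∎
  where
  open ≡-Reasoning
  M = minor F.zero P
  T = borderCofactorSum M
  lemma : ∀ s n d t → s * s * (d - t) ≡ s * (s + n) * d - s * (n * d + s * t)
  lemma = solve-∀

-- Principal submatrices of order one less

punchIn-strictlyIncreasing : ∀ {k} (u : Fin (suc k)) → StrictlyIncreasing (punchIn u)
punchIn-strictlyIncreasing u i j i<j = ℕP.≤∧≢⇒< (FP.punchIn-mono-≤ u i j (ℕP.<⇒≤ i<j))
  (λ e → ℕP.<⇒≢ i<j (cong toℕ (FP.punchIn-injective u i j (FP.toℕ-injective e))))

module _ {k n} {f : Fin (suc k) → Fin (suc n)} (f↑ : StrictlyIncreasing f) where

  StrictlyIncreasing-tail : StrictlyIncreasing (f ∘ F.suc)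
  StrictlyIncreasing-tail i j i<j = f↑ (F.suc i) (F.suc j) (ℕ.s≤s i<j)

  StrictlyIncreasing-tail≢0 : ∀ i → F.zero ≢ f (F.suc i)
  StrictlyIncreasing-tail≢0 i e =
    ℕP.n≮0 (subst (λ y → toℕ (f F.zero) < toℕ y) (sym e) (f↑ F.zero (F.suc i) (ℕ.s≤s ℕ.z≤n)))

  StrictlyIncreasing-head≢0 : F.zero ≢ f F.zero → ∀ i → F.zero ≢ f i
  StrictlyIncreasing-head≢0 f0≢0 F.zero    = f0≢0
  StrictlyIncreasing-head≢0 f0≢0 (F.suc i) = StrictlyIncreasing-tail≢0 i

StrictlyIncreasing-punchOut₀ : ∀ {k n} {f : Fin k → Fin (suc n)} (f≢0 : ∀ i → F.zero ≢ f i) →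
                               StrictlyIncreasing f → StrictlyIncreasing (λ i → punchOut (f≢0 i))
StrictlyIncreasing-punchOut₀ {f = f} f≢0 f↑ i j i<j =
  ℕ.s≤s⁻¹ (subst₂ _<_ (suc-punchOut (f i) (f≢0 i)) (suc-punchOut (f j) (f≢0 j)) (f↑ i j i<j))
  where
  suc-punchOut : ∀ {n} (y : Fin (suc n)) (y≢0 : F.zero ≢ y) → toℕ y ≡ suc (toℕ (punchOut y≢0))
  suc-punchOut F.zero           y≢0 = contradiction refl y≢0
  suc-punchOut {suc n} (F.suc y) y≢0 = refl

¬StrictlyIncreasing-shrinking : ∀ k (g : Fin (suc k) → Fin k) → ¬ StrictlyIncreasing g
¬StrictlyIncreasing-shrinking k g g↑ with FP.pigeonhole (ℕP.n<1+n k) g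
... | i , j , i<j , gi≡gj = ℕP.<-irrefl (cong toℕ gi≡gj) (g↑ i j i<j)

StrictlyIncreasing-endo⇒id : ∀ k (g : Fin k → Fin k) → StrictlyIncreasing g → ∀ i → g i ≡ i
StrictlyIncreasing-endo⇒id (suc k) g g↑ i with g F.zero in g0
... | F.suc w = contradiction (StrictlyIncreasing-punchOut₀ g≢0 g↑) (¬StrictlyIncreasing-shrinking k _)
  where g≢0 = StrictlyIncreasing-head≢0 g↑ (λ e → FP.0≢1+n (trans e g0))
... | F.zero = go i
  where
  tail≡id : ∀ i → punchOut (StrictlyIncreasing-tail≢0 g↑ i) ≡ i
  tail≡id = StrictlyIncreasing-endo⇒id k _
              (StrictlyIncreasing-punchOut₀ (StrictlyIncreasing-tail≢0 g↑) (StrictlyIncreasing-tail g↑))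
  go : ∀ i → g i ≡ i
  go F.zero    = g0
  go (F.suc i) = trans (sym (FP.punchIn-punchOut (StrictlyIncreasing-tail≢0 g↑ i))) (cong F.suc (tail≡id i))

StrictlyIncreasing⇒punchIn : ∀ m (f : Fin m → Fin (suc m)) → StrictlyIncreasing f → ∃[ u ] ∀ i → f i ≡ punchIn u i
StrictlyIncreasing⇒punchIn zero    f f↑ = F.zero , λ ()
StrictlyIncreasing⇒punchIn (suc m) f f↑ with f F.zero in f0
... | F.zero = F.suc u , go
  where
  f≢0 = StrictlyIncreasing-tail≢0 f↑
  ih = StrictlyIncreasing⇒punchIn m _ (StrictlyIncreasing-punchOut₀ f≢0 (StrictlyIncreasing-tail f↑))
  u = proj₁ ih
  go : ∀ i → f i ≡ punchIn (F.suc u) i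
  go F.zero    = f0
  go (F.suc i) = trans (sym (FP.punchIn-punchOut (f≢0 i))) (cong F.suc (proj₂ ih i))
... | F.suc w = F.zero , λ i → trans (sym (FP.punchIn-punchOut (f≢0 i))) (cong F.suc (endo i))
  where
  f≢0 = StrictlyIncreasing-head≢0 f↑ (λ e → FP.0≢1+n (trans e f0))
  endo = StrictlyIncreasing-endo⇒id (suc m) _ (StrictlyIncreasing-punchOut₀ f≢0 f↑)

sumFin-cong : ∀ {n} {f g : Fin n → Poly} → (∀ i → f i ≡ g i) → sumFin f ≡ sumFin g
sumFin-cong {zero}  f≡g = refl
sumFin-cong {suc n} f≡g = cong₂ _+ₚ_ (f≡g F.zero) (sumFin-cong (f≡g ∘ F.suc))

det-cong : ∀ k {M N : Fin k → Fin k → Poly} → (∀ i j → M i j ≡ N i j) → det k M ≡ det k N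
det-cong zero    M≡N = refl
det-cong (suc k) M≡N = sumFin-cong λ j →
  cong (scaleₚ (sgn (toℕ j))) (cong₂ _*ₚ_ (M≡N F.zero j) (det-cong k λ r c → M≡N (F.suc r) (punchIn j c)))

SpectrallyMonomorphic⇔punchIn : ∀ m (X : Mat (suc m)) →
  SpectrallyMonomorphic m X ⇔ (∀ u v → charPoly m (principalSub (punchIn u) X) ≈ₚ charPoly m (principalSub (punchIn v) X))
SpectrallyMonomorphic⇔punchIn m X = mk⇔
  (λ mono u v → mono (punchIn u) (punchIn v) (punchIn-strictlyIncreasing u) (punchIn-strictlyIncreasing v))
  (λ mono f g f↑ g↑ i → let (u , f≗) = StrictlyIncreasing⇒punchIn m f f↑
                            (v , g≗) = StrictlyIncreasing⇒punchIn m g g↑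
                        in trans (cong (λ p → coeff p i) (charPoly-cong f≗))
                                 (trans (mono u v i) (cong (λ p → coeff p i) (sym (charPoly-cong g≗)))))
  where
  charPoly-cong : ∀ {f f′ : Fin m → Fin (suc m)} → (∀ i → f i ≡ f′ i) →
                  charPoly m (principalSub f X) ≡ charPoly m (principalSub f′ X)
  charPoly-cong f≗f′ = det-cong m λ i j →
    cong (λ a → (if does (i F.≟ j) then Xₚ else []) +ₚ negₚ (constₚ a)) (cong₂ X (f≗f′ i) (f≗f′ j))

-- Tournaments

scalarMat-diag : ∀ {k} x (i : Fin k) → scalarMat x i i ≡ x
scalarMat-diag x i = cong (λ b → if b then x else + 0) (dec-true (i F.≟ i) refl)

scalarMat-off : ∀ {k} x {i j : Fin k} → i ≢ j → scalarMat x i j ≡ + 0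
scalarMat-off x {i} {j} i≢j = cong (λ b → if b then x else + 0) (dec-false (i F.≟ j) i≢j)

scalarMat-sub : ∀ {k} x y (i j : Fin k) → scalarMat x i j - scalarMat y i j ≡ scalarMat (x - y) i j
scalarMat-sub x y i j with does (i F.≟ j)
... | true  = refl
... | false = refl

scalarMat-scale : ∀ {k} c x (i j : Fin k) → scalarMat (c * x) i j ≡ c * scalarMat x i j
scalarMat-scale c x i j with does (i F.≟ j)
... | true  = refl
... | false = sym (ℤP.*-zeroʳ c)

scalarMat-punchIn : ∀ {k} x (v : Fin (suc k)) (i j : Fin k) → scalarMat x (punchIn v i) (punchIn v j) ≡ scalarMat x i j
scalarMat-punchIn x v i j with i F.≟ j
... | yes refl = scalarMat-diag x (punchIn v i)
... | no  i≢j  = scalarMat-off x (i≢j ∘ FP.punchIn-injective v i j)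

sum-scalarMat-row : ∀ {k} x (i : Fin (suc k)) → sum (scalarMat x i) ≡ x
sum-scalarMat-row x i = begin
  sum (scalarMat x i)                                  ≡⟨ sum-remove {i = i} (scalarMat x i) ⟩
  scalarMat x i i + sum (λ c → scalarMat x i (punchIn i c))
    ≡⟨ cong₂ _+_ (scalarMat-diag x i) (sum-zero λ c → scalarMat-off x (FP.punchInᵢ≢i i c ∘ sym)) ⟩
  x + + 0                                              ≡⟨ ℤP.+-identityʳ x ⟩
  x                                                    ∎
  where open ≡-Reasoning

sum-scalarMat-col : ∀ {k} x (j : Fin (suc k)) → sum (λ i → scalarMat x i j) ≡ x
sum-scalarMat-col x j = begin
  sum (λ i → scalarMat x i j)                          ≡⟨ sum-remove {i = j} (λ i → scalarMat x i j) ⟩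
  scalarMat x j j + sum (λ c → scalarMat x (punchIn j c) j)
    ≡⟨ cong₂ _+_ (scalarMat-diag x j) (sum-zero λ c → scalarMat-off x (FP.punchInᵢ≢i j c)) ⟩
  x + + 0                                              ≡⟨ ℤP.+-identityʳ x ⟩
  x                                                    ∎
  where open ≡-Reasoning

sum-b2z : ∀ {n} (p : Fin n → Bool) → sum (λ j → b2z (p j)) ≡ + countFin p
sum-b2z {zero}  p = refl
sum-b2z {suc n} p with p F.zero
... | true  = trans (cong (λ e → + 1 + e) (sum-b2z (p ∘ F.suc))) (sym (ℤP.pos-+ 1 _))
... | false = trans (cong (λ e → + 0 + e) (sum-b2z (p ∘ F.suc))) (sym (ℤP.pos-+ 0 _))

module _ {n} (T : Tournament n) where

  adj-rowSum : ∀ i → sum (adj T i) ≡ + outdeg T i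
  adj-rowSum i = sum-b2z (dom T i)

  adj+adjᵀ : ∀ i j → adj T i j + adj T j i ≡ + 1 - scalarMat (+ 1) i j
  adj+adjᵀ i j with i F.≟ j
  ... | yes refl = cong (λ b → b2z b + b2z b) (irrefl T i)
  ... | no  i≢j  = entries (dom T i j) refl
    where
    entries : ∀ b → dom T i j ≡ b → b2z b + adj T j i ≡ + 1 - + 0
    entries true  ij = cong (λ b → + 1 + b2z b) (total T i j i≢j ij)
    entries false ij = cong (λ b → + 0 + b2z b) (connex T i j i≢j ij)

  skewAdj≡ : ∀ i j → skewAdj T i j ≡ + 2 * adj T i j - (+ 1 - scalarMat (+ 1) i j)
  skewAdj≡ i j = begin
    adj T i j - adj T j i                          ≡⟨ lemma (adj T i j) (adj T j i) ⟩
    + 2 * adj T i j - (adj T i j + adj T j i)      ≡⟨ cong (λ e → + 2 * adj T i j - e) (adj+adjᵀ i j) ⟩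
    + 2 * adj T i j - (+ 1 - scalarMat (+ 1) i j)  ∎
    where
    open ≡-Reasoning
    lemma : ∀ a b → a - b ≡ + 2 * a - (a + b)
    lemma = solve-∀

adj-colSum : ∀ {m} (T : Tournament (suc m)) j → sum (λ i → adj T i j) ≡ + m - + outdeg T j
adj-colSum {m} T j = begin
  sum (λ i → adj T i j)                                           ≡⟨ lemma (sum (λ i → adj T i j)) (sum (adj T j)) ⟩
  sum (λ i → adj T i j) + sum (adj T j) - sum (adj T j)
    ≡⟨ cong₂ (λ x y → x - y) (sym (∑-distrib-+ (λ i → adj T i j) (adj T j))) (adj-rowSum T j) ⟩
  sum (λ i → adj T i j + adj T j i) - + outdeg T j
    ≡⟨ cong (λ e → e - + outdeg T j)
            (trans (sum-cong-≗ λ i → adj+adjᵀ T i j) (sum-sub (λ _ → + 1) (λ i → scalarMat (+ 1) i j))) ⟩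
  sum {suc m} (λ _ → + 1) - sum (λ i → scalarMat (+ 1) i j) - + outdeg T j
    ≡⟨ cong₂ (λ x y → x - y - + outdeg T j) (trans (sum-const (suc m) (+ 1)) (ℤP.*-identityʳ (+ suc m)))
                                             (sum-scalarMat-col (+ 1) j) ⟩
  + suc m - + 1 - + outdeg T j
    ≡⟨ cong (λ e → e - + 1 - + outdeg T j) (ℤP.pos-+ 1 m) ⟩
  + 1 + + m - + 1 - + outdeg T j                                  ≡⟨ lemma′ (+ m) (+ outdeg T j) ⟩
  + m - + outdeg T j                                              ∎
  where
  open ≡-Reasoning
  lemma : ∀ x y → x ≡ x + y - y
  lemma = solve-∀
  lemma′ : ∀ m d → + 1 + m - + 1 - d ≡ m - d
  lemma′ = solve-∀

module RegularTournament {m} (T : Tournament (suc m)) (d : ℕ) (regular : ∀ i → outdeg T i ≡ d) where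

  A : Mat (suc m)
  A = adj T

  A-rowSum : ∀ i → sum (A i) ≡ + d
  A-rowSum i = trans (adj-rowSum T i) (cong +_ (regular i))

  d≡m-d : + d ≡ + m - + d
  d≡m-d = ℤP.*-cancelˡ-≡ (+ suc m) (+ d) (+ m - + d) (begin
    + suc m * + d                            ≡⟨ sym (sum-const (suc m) (+ d)) ⟩
    sum {suc m} (λ _ → + d)                  ≡⟨ sym (sum-cong-≗ A-rowSum) ⟩
    sum (λ i → sum (A i))                    ≡⟨ ∑-comm (λ i j → A i j) ⟩
    sum (λ j → sum λ i → A i j)
      ≡⟨ sum-cong-≗ (λ j → trans (adj-colSum T j) (cong (λ e → + m - + e) (regular j))) ⟩
    sum {suc m} (λ _ → + m - + d)            ≡⟨ sum-const (suc m) (+ m - + d) ⟩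
    + suc m * (+ m - + d)                    ∎)
    where open ≡-Reasoning

  A-colSum : ∀ j → sum (λ i → A i j) ≡ + d
  A-colSum j = trans (adj-colSum T j) (trans (cong (λ e → + m - + e) (regular j)) (sym d≡m-d))

  Y : ℤ → Mat (suc m)
  Y z i j = scalarMat (z - + 1) i j - + 2 * A i j

  lineSum : ℤ → ℤ
  lineSum z = z - + 1 - + 2 * + d

  Y-rowSum : ∀ z i → sum (Y z i) ≡ lineSum z
  Y-rowSum z i = trans (sum-sub (scalarMat (z - + 1) i) (λ j → + 2 * A i j))
    (cong₂ _-_ (sum-scalarMat-row (z - + 1) i) (trans (sym (*-distribˡ-sum (+ 2) (A i))) (cong (+ 2 *_) (A-rowSum i))))

  Y-colSum : ∀ z j → sum (λ i → Y z i j) ≡ lineSum z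
  Y-colSum z j = trans (sum-sub (λ i → scalarMat (z - + 1) i j) (λ i → + 2 * A i j))
    (cong₂ _-_ (sum-scalarMat-col (z - + 1) j) (trans (sym (*-distribˡ-sum (+ 2) (λ i → A i j))) (cong (+ 2 *_) (A-colSum j))))

  Y-skewEntry : ∀ z i j → scalarMat z i j - skewAdj T i j ≡ Y z i j + + 1
  Y-skewEntry z i j = begin
    scalarMat z i j - skewAdj T i j
      ≡⟨ cong (λ e → scalarMat z i j - e) (skewAdj≡ T i j) ⟩
    scalarMat z i j - (+ 2 * A i j - (+ 1 - scalarMat (+ 1) i j))
      ≡⟨ lemma (scalarMat z i j) (scalarMat (+ 1) i j) (A i j) ⟩
    scalarMat z i j - scalarMat (+ 1) i j - + 2 * A i j + + 1
      ≡⟨ cong (λ e → e - + 2 * A i j + + 1) (scalarMat-sub z (+ 1) i j) ⟩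
    Y z i j + + 1 ∎
    where
    open ≡-Reasoning
    lemma : ∀ x y a → x - (+ 2 * a - (+ 1 - y)) ≡ x - y - + 2 * a + + 1
    lemma = solve-∀

  Y-adjEntry : ∀ x i j → Y (+ 2 * x + + 1) i j ≡ + 2 * (scalarMat x i j - A i j)
  Y-adjEntry x i j = begin
    scalarMat (+ 2 * x + + 1 - + 1) i j - + 2 * A i j
      ≡⟨ cong (λ e → scalarMat e i j - + 2 * A i j) (lemma x) ⟩
    scalarMat (+ 2 * x) i j - + 2 * A i j
      ≡⟨ cong (λ e → e - + 2 * A i j) (scalarMat-scale (+ 2) x i j) ⟩
    + 2 * scalarMat x i j - + 2 * A i j
      ≡⟨ lemma′ (scalarMat x i j) (A i j) ⟩
    + 2 * (scalarMat x i j - A i j) ∎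
    where
    open ≡-Reasoning
    lemma : ∀ x → + 2 * x + + 1 - + 1 ≡ + 2 * x
    lemma = solve-∀
    lemma′ : ∀ x a → + 2 * x - + 2 * a ≡ + 2 * (x - a)
    lemma′ = solve-∀

  minorY : ℤ → Fin (suc m) → ℤ
  minorY z v = detℤ m (λ i j → Y z (punchIn v i) (punchIn v j))

  minorY+J : ℤ → Fin (suc m) → ℤ
  minorY+J z v = detℤ m (λ i j → Y z (punchIn v i) (punchIn v j) + + 1)

  minorY+J≡ : ∀ z v → lineSum z * lineSum z * minorY+J z v ≡
                      lineSum z * (lineSum z + + suc m) * minorY z v - detℤ (suc m) (Y z)
  minorY+J≡ z v =
    trans (constantLineSums⇒detℤ-minor+J m P (lineSum z)
            (λ i → trans (sum-toFront v (Y z (toFront v i))) (Y-rowSum z (toFront v i)))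
            (λ j → trans (sum-toFront v (λ i → Y z i (toFront v j))) (Y-colSum z (toFront v j))))
          (cong (λ e → lineSum z * (lineSum z + + suc m) * minorY z v - e) (detℤ-conjugateToFront m v (Y z)))
    where
    P : Mat (suc m)
    P i j = Y z (toFront v i) (toFront v j)

  adjCharPoly skewCharPoly : Fin (suc m) → Poly
  adjCharPoly v  = charPoly m (principalSub (punchIn v) A)
  skewCharPoly v = charPoly m (principalSub (punchIn v) (skewAdj T))

  eval-skewCharPoly : ∀ z v → eval (skewCharPoly v) z ≡ minorY+J z v
  eval-skewCharPoly z v = trans (eval-charPoly m (principalSub (punchIn v) (skewAdj T)) z) (detℤ-cong m λ i j →
    trans (cong (λ e → e - skewAdj T (punchIn v i) (punchIn v j)) (sym (scalarMat-punchIn z v i j)))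
          (Y-skewEntry z (punchIn v i) (punchIn v j)))

  eval-adjCharPoly : ∀ x v → (+ 2) ℤ.^ m * eval (adjCharPoly v) x ≡ minorY (+ 2 * x + + 1) v
  eval-adjCharPoly x v = begin
    (+ 2) ℤ.^ m * eval (adjCharPoly v) x
      ≡⟨ cong ((+ 2) ℤ.^ m *_) (eval-charPoly m (principalSub (punchIn v) A) x) ⟩
    (+ 2) ℤ.^ m * detℤ m (λ i j → scalarMat x i j - A (punchIn v i) (punchIn v j))
      ≡⟨ sym (detℤ-scale m (+ 2) (λ i j → scalarMat x i j - A (punchIn v i) (punchIn v j))) ⟩
    detℤ m (λ i j → + 2 * (scalarMat x i j - A (punchIn v i) (punchIn v j)))
      ≡⟨ detℤ-cong m (λ i j → trans (cong (λ e → + 2 * (e - A (punchIn v i) (punchIn v j))) (sym (scalarMat-punchIn x v i j)))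
                                    (sym (Y-adjEntry x (punchIn v i) (punchIn v j)))) ⟩
    minorY (+ 2 * x + + 1) v ∎
    where open ≡-Reasoning

  cancel : ∀ c {x y} → c ≢ + 0 → c * x ≡ c * y → x ≡ y
  cancel c c≢0 = ℤP.*-cancelˡ-≡ c _ _ {{ℤ.≢-nonZero c≢0}}

  minorY≡⇒minorY+J≡ : ∀ z u v → lineSum z ≢ + 0 → minorY z u ≡ minorY z v → minorY+J z u ≡ minorY+J z v
  minorY≡⇒minorY+J≡ z u v s≢0 eq = cancel s s≢0 (cancel s s≢0 (begin
    s * (s * minorY+J z u)                   ≡⟨ sym (ℤP.*-assoc s s _) ⟩
    s * s * minorY+J z u                     ≡⟨ minorY+J≡ z u ⟩
    s * (s + + suc m) * minorY z u - detℤ (suc m) (Y z)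
      ≡⟨ cong (λ e → s * (s + + suc m) * e - detℤ (suc m) (Y z)) eq ⟩
    s * (s + + suc m) * minorY z v - detℤ (suc m) (Y z)
      ≡⟨ sym (minorY+J≡ z v) ⟩
    s * s * minorY+J z v                     ≡⟨ ℤP.*-assoc s s _ ⟩
    s * (s * minorY+J z v)                   ∎))
    where
    open ≡-Reasoning
    s = lineSum z

  minorY+J≡⇒minorY≡ : ∀ z u v → lineSum z * (lineSum z + + suc m) ≢ + 0 →
                      minorY+J z u ≡ minorY+J z v → minorY z u ≡ minorY z v
  minorY+J≡⇒minorY≡ z u v c≢0 eq = cancel c c≢0 (begin
    c * minorY z u                                    ≡⟨ lemma (c * minorY z u) (detℤ (suc m) (Y z)) ⟩
    c * minorY z u - detℤ (suc m) (Y z) + detℤ (suc m) (Y z)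
      ≡⟨ cong (_+ detℤ (suc m) (Y z)) (trans (sym (minorY+J≡ z u)) (trans (cong (s * s *_) eq) (minorY+J≡ z v))) ⟩
    c * minorY z v - detℤ (suc m) (Y z) + detℤ (suc m) (Y z)
      ≡⟨ sym (lemma (c * minorY z v) (detℤ (suc m) (Y z))) ⟩
    c * minorY z v                                    ∎)
    where
    open ≡-Reasoning
    s = lineSum z
    c = s * (s + + suc m)
    lemma : ∀ x y → x ≡ x - y + y
    lemma = solve-∀

  sample : ℕ → ℕ
  sample e = d ℕ.+ suc e

  lineSum-sample : ∀ e → lineSum (+ 2 * + sample e + + 1) ≡ + 2 * + suc e
  lineSum-sample e = trans (cong (λ t → lineSum (+ 2 * t + + 1)) (ℤP.pos-+ d (suc e))) (lemma (+ d) (+ suc e))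
    where lemma : ∀ d s → + 2 * (d + s) + + 1 - + 1 - + 2 * d ≡ + 2 * s
          lemma = solve-∀

  lineSum-sample≢0 : ∀ e → lineSum (+ 2 * + sample e + + 1) ≢ + 0
  lineSum-sample≢0 e eq = 2[1+e]≢0 (trans (sym (lineSum-sample e)) eq)
    where 2[1+e]≢0 : + 2 * + suc e ≢ + 0
          2[1+e]≢0 ()

  lineSum*[lineSum+n]-sample≢0 : ∀ e → let s = lineSum (+ 2 * + sample e + + 1) in s * (s + + suc m) ≢ + 0
  lineSum*[lineSum+n]-sample≢0 e eq = ≢0 (trans (cong (λ s → s * (s + + suc m)) (sym (lineSum-sample e))) eq)
    where ≢0 : + 2 * + suc e * (+ 2 * + suc e + + suc m) ≢ + 0
          ≢0 ()

  N≤sample : ∀ N → N ≤ sample N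
  N≤sample N = ℕP.≤-trans (ℕP.n≤1+n N) (ℕP.m≤n+m (suc N) d)

  adj⇒skew : (∀ u v → adjCharPoly u ≈ₚ adjCharPoly v) →
             ∀ u v → skewCharPoly u ≈ₚ skewCharPoly v
  adj⇒skew mono u v = agreeInfinitelyOften⇒≈ₚ (skewCharPoly u) (skewCharPoly v) agree
    where
    agree : InfinitelyMany λ t → eval (skewCharPoly u) (+ t) ≡
                                 eval (skewCharPoly v) (+ t)
    agree N = t , ℕP.≤-trans (N≤sample N) (ℕP.≤-trans (ℕP.m≤m+n (sample N) _) (ℕP.m≤m+n (2 ℕ.* sample N) 1)) ,
              (begin
      eval (skewCharPoly u) (+ t)  ≡⟨ cong (eval (skewCharPoly u)) t≡z ⟩
      eval (skewCharPoly u) z      ≡⟨ eval-skewCharPoly z u ⟩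
      minorY+J z u                                                   ≡⟨ minorY≡⇒minorY+J≡ z u v (lineSum-sample≢0 N) minorY-agree ⟩
      minorY+J z v                                                   ≡⟨ sym (eval-skewCharPoly z v) ⟩
      eval (skewCharPoly v) z      ≡⟨ cong (eval (skewCharPoly v)) (sym t≡z) ⟩
      eval (skewCharPoly v) (+ t)  ∎)
      where
      open ≡-Reasoning
      t = 2 ℕ.* sample N ℕ.+ 1
      z = + 2 * + sample N + + 1
      t≡z : + t ≡ z
      t≡z = trans (ℤP.pos-+ (2 ℕ.* sample N) 1) (cong (_+ + 1) (ℤP.pos-* 2 (sample N)))
      minorY-agree : minorY z u ≡ minorY z v
      minorY-agree = begin
        minorY z u                                                           ≡⟨ sym (eval-adjCharPoly (+ sample N) u) ⟩
        (+ 2) ℤ.^ m * eval (adjCharPoly u) (+ sample N)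
          ≡⟨ cong ((+ 2) ℤ.^ m *_) (eval-cong (adjCharPoly u) (adjCharPoly v) (mono u v) (+ sample N)) ⟩
        (+ 2) ℤ.^ m * eval (adjCharPoly v) (+ sample N)  ≡⟨ eval-adjCharPoly (+ sample N) v ⟩
        minorY z v                                                           ∎

  skew⇒adj : (∀ u v → skewCharPoly u ≈ₚ skewCharPoly v) →
             ∀ u v → adjCharPoly u ≈ₚ adjCharPoly v
  skew⇒adj mono u v = agreeInfinitelyOften⇒≈ₚ (adjCharPoly u) (adjCharPoly v) agree
    where
    agree : InfinitelyMany λ t → eval (adjCharPoly u) (+ t) ≡
                                 eval (adjCharPoly v) (+ t)
    agree N = sample N , N≤sample N , cancel ((+ 2) ℤ.^ m) 2^m≢0 (begin
      (+ 2) ℤ.^ m * eval (adjCharPoly u) (+ sample N)  ≡⟨ eval-adjCharPoly (+ sample N) u ⟩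
      minorY z u   ≡⟨ minorY+J≡⇒minorY≡ z u v (lineSum*[lineSum+n]-sample≢0 N) minorY+J-agree ⟩
      minorY z v   ≡⟨ sym (eval-adjCharPoly (+ sample N) v) ⟩
      (+ 2) ℤ.^ m * eval (adjCharPoly v) (+ sample N)  ∎)
      where
      open ≡-Reasoning
      z = + 2 * + sample N + + 1
      2^m≢0 : (+ 2) ℤ.^ m ≢ + 0
      2^m≢0 eq with () ← ℤP.i^n≡0⇒i≡0 (+ 2) m eq
      minorY+J-agree : minorY+J z u ≡ minorY+J z v
      minorY+J-agree = trans (sym (eval-skewCharPoly z u))
                             (trans (eval-cong (skewCharPoly u) (skewCharPoly v) (mono u v) z) (eval-skewCharPoly z v))

proposition5p5 : ∀ (n : ℕ) (T : Tournament n) → Regular T →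
    (kSpecMono (n ∸ 1) T ⇔ kSkewSpecMono (n ∸ 1) T)
proposition5p5 zero    T _ = mk⇔ (λ _ _ _ _ _ _ → refl) (λ _ _ _ _ _ _ → refl)
proposition5p5 (suc m) T (d , regular) = mk⇔
  (λ mono → from (SpectrallyMonomorphic⇔punchIn m (skewAdj T)) (adj⇒skew (to (SpectrallyMonomorphic⇔punchIn m (adj T)) mono)))
  (λ mono → from (SpectrallyMonomorphic⇔punchIn m (adj T)) (skew⇒adj (to (SpectrallyMonomorphic⇔punchIn m (skewAdj T)) mono)))
  where
  open RegularTournament T d regular
  open Equivalence
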